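{- Let $n\ge 2$. The number $N_n$ of Grassmanian $n$-cycles in $\mathcal{S}_n$ is $$N_n=\frac1n\sum_{d\mid n,\ d\neq n}\mu(d)\left(2^{n/d}-2\right).$$ In particular, if $n=p$ is prime, then $N_p=\frac1p(2^p-2)$.
   Context: $\mathcal{S}_n$ is the symmetric group on $[n]$. An $n$-cycle is a permutation in $\mathcal{S}_n$ whose cycle decomposition consists of a single cycle of length $n$. For $\pi\in\mathcal{S}_n$, $\operatorname{des}(\pi)$ is the number of $i\in[n-1]$ with $\pi(i)>\pi(i+1)$; $\pi$ is Grassmanian if $\operatorname{des}(\pi)\le 1$. $\mu$ is the Möbius function. -}

module Defs where

open import Data.Bool using (Bool; true; false; _∧_; not; if_then_else_)
open import Data.Nat using (ℕ; zero; suc; _+_; _*_; _∸_; _^_; _≤ᵇ_; _<ᵇ_; _≡ᵇ_)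
open import Data.Nat.Divisibility using (_∣?_)
open import Data.Nat.Primality using (prime?)
open import Data.Fin using (Fin; toℕ) renaming (zero to fzero; suc to fsuc)
open import Data.Fin.Properties using (_≟_)
open import Data.Vec using (Vec; []; _∷_; lookup; toList)
open import Data.List using (List; []; _∷_; map; concatMap; filterᵇ; length; allFin; and; upTo)
open import Data.List.Relation.Unary.Unique.DecPropositional using (unique?)
open import Data.Integer using (ℤ; +_; -_) renaming (_+_ to _+ℤ_; _*_ to _*ℤ_; _-_ to _-ℤ_)
open import Relation.Nullary using (does)

-- Permutations of [n] in one-line notation: π is the word
-- (π(1), …, π(n)) ∈ (Fin n)^n, where Fin n represents [n] via i ↦ i+1
-- (order preserving, so descents are unaffected).

all : {A : Set} → (A → Bool) → List A → Bool
all p []       = true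
all p (x ∷ xs) = p x ∧ all p xs

allWords : (k n : ℕ) → List (Vec (Fin n) k)
allWords zero    n = [] ∷ []
allWords (suc k) n = concatMap (λ x → map (x ∷_) (allWords k n)) (allFin n)

isPerm : ∀ {n} → Vec (Fin n) n → Bool
isPerm v = does (unique? _≟_ (toList v))

desW : ∀ {n k} → Vec (Fin n) k → ℕ
desW []           = 0
desW (x ∷ [])     = 0
desW (x ∷ y ∷ xs) = (if toℕ y <ᵇ toℕ x then 1 else 0) + desW (y ∷ xs)

des : ∀ {n} → Vec (Fin n) n → ℕ
des = desW

isGrassmannian : ∀ {n} → Vec (Fin n) n → Bool
isGrassmannian π = des π ≤ᵇ 1

iter : ∀ {n} → Vec (Fin n) n → ℕ → Fin n → Fin n
iter π zero    i = i
iter π (suc k) i = lookup π (iter π k i)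

-- π (a permutation) is an n-cycle iff the cycle through the point 1
-- (= fzero) has length n, i.e. π^k(1) ≠ 1 for all 1 ≤ k < n.
-- (Then that cycle contains all n points, so the cycle decomposition
-- is a single n-cycle; conversely an n-cycle has this property.)
isNCycle : ∀ {n} → Vec (Fin n) n → Bool
isNCycle {zero}  π = false
isNCycle {suc m} π =
  all (λ k → not (toℕ (iter π (suc k) fzero) ≡ᵇ 0)) (upTo m)

N : ℕ → ℕ
N n = length (filterᵇ (λ π → isPerm π ∧ isNCycle π ∧ isGrassmannian π)
                      (allWords n n))

-- Möbius function (classical definition):
-- μ(d) = 0 if p² ∣ d for some prime p, otherwise (-1)^(number of primes
-- dividing d).  (μ(0) is never used.)

primeDivisors : ℕ → List ℕ
primeDivisors d =
  filterᵇ (λ p → does (prime? p) ∧ does (p ∣? d)) (upTo (suc d))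

squarefree : ℕ → Bool
squarefree d = all (λ p → not (does ((p * p) ∣? d))) (primeDivisors d)

μ : ℕ → ℤ
μ d = if squarefree d then sign (length (primeDivisors d)) else + 0
  where
  sign : ℕ → ℤ
  sign zero    = + 1
  sign (suc k) = - sign k

-- Σ_{d ∣ n, d ≠ n} f(d, n/d): sum over divisors 1 ≤ d < n of n,
-- with the cofactor n/d passed as the second argument.
sumProperDivisors : ℕ → (ℕ → ℕ → ℤ) → ℤ
sumProperDivisors n f =
  Data.List.foldr _+ℤ_ (+ 0)
    (concatMap (λ d → concatMap (λ e →
       if (1 ≤ᵇ d) ∧ (d <ᵇ n) ∧ (d * e ≡ᵇ n) then f d e ∷ [] else [])
         (upTo (suc n))) (upTo (suc n)))

{-# OPTIONS --safe #-}
module Submission where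

-- A Grassmannian n-cycle π (n ≥ 2) has exactly one descent, say at position k, and is
-- increasing on the blocks {1..k} and {k+1..n}. Colouring each point by its block and
-- reading the colours along the cycle from a starting point x gives a binary word
-- w(π, x). Since π is increasing on each block, x < y exactly when the word read from x
-- is lexicographically smaller than the word read from y. So w(π, x) is primitive, and
-- (π, x) is recovered from it: x is the rank of w among its rotations, and π sends the
-- rank of each rotation to the rank of the next one. Hence n N_n is the number P(n) of
-- primitive binary words of length n. Every binary word of length m has a unique
-- minimal period, which divides m, so ∑_{d ∣ m} P(d) = 2^m, and Möbius inversion gives
-- P(n) = ∑_{d ∣ n} μ(d) 2^{n/d}. Since ∑_{d ∣ n} μ(d) = 0 for n ≥ 2, subtracting 2 from
-- every term and dropping the term d = n (which then vanishes) changes nothing.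

open import Defs
open import Data.Bool using (Bool; true; false; _∧_; not; if_then_else_)
import Data.Bool.Properties as Boolₚ
open import Data.Empty using (⊥-elim)
open import Data.Fin using (Fin; toℕ; fromℕ<) renaming (zero to fzero; suc to fsuc)
import Data.Fin.Properties as Finₚ
open import Data.Integer using (ℤ; +_; -_)
import Data.Integer.Properties as ℤₚ
open import Data.List using (List; []; _∷_; map; concatMap; _++_; filterᵇ; length; upTo; allFin)
import Data.List.Properties as Listₚ
open import Data.List.Membership.Propositional using (_∈_)
import Data.List.Membership.Propositional.Properties as ∈ₚ
open import Data.List.Relation.Unary.Any using (here; there)
open import Data.Nat using (ℕ; zero; suc; _≤_; _<_; z≤n; s≤s; _≟_; _≤?_; _<?_; _≤ᵇ_; _<ᵇ_; _≡ᵇ_)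
import Data.Nat.Properties as ℕₚ
open import Data.Product using (Σ-syntax; _×_; _,_; proj₁; proj₂)
import Data.Product.Properties as Productₚ
open import Data.Sum using (_⊎_; inj₁; inj₂)
open import Data.Vec using (Vec; []; _∷_; lookup; tabulate)
import Data.Vec.Properties as Vecₚ
open import Function using (_∘_)
open import Function.Bundles using (Equivalence)
open import Relation.Binary.Definitions using (DecidableEquality; tri<; tri≈; tri>)
open import Relation.Binary.PropositionalEquality
open import Relation.Nullary using (Dec; yes; no; does; ¬_; _×-dec_)
open import Relation.Nullary.Decidable using (dec-true; dec-false; T?; decidable-stable)

private
  variable
    A B C : Set

module Booleans where

  dec-witness : {P : Set} (p? : Dec P) → does p? ≡ true → P
  dec-witness (yes p) _ = p

  ∧-elim : ∀ {a b} → (a ∧ b) ≡ true → a ≡ true × b ≡ true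
  ∧-elim {true} {true} _ = refl , refl

  ∧-intro : ∀ {a b} → a ≡ true → b ≡ true → (a ∧ b) ≡ true
  ∧-intro refl refl = refl

  ≡-by-≡true : ∀ {a b : Bool} → (a ≡ true → b ≡ true) → (b ≡ true → a ≡ true) → a ≡ b
  ≡-by-≡true {true}  {true}  _ _ = refl
  ≡-by-≡true {true}  {false} f _ = sym (f refl)
  ≡-by-≡true {false} {true}  _ g = g refl
  ≡-by-≡true {false} {false} _ _ = refl

  false≢true : false ≢ true
  false≢true ()

  all⁻ : ∀ (f : A → Bool) {xs} → all f xs ≡ true → ∀ {y} → y ∈ xs → f y ≡ true
  all⁻ f {x ∷ xs} h (here refl) = proj₁ (∧-elim h)
  all⁻ f {x ∷ xs} h (there y∈xs) = all⁻ f (proj₂ (∧-elim {f x} h)) y∈xs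

  all⁺ : ∀ (f : A → Bool) xs → (∀ {y} → y ∈ xs → f y ≡ true) → all f xs ≡ true
  all⁺ f []       _ = refl
  all⁺ f (x ∷ xs) h = ∧-intro (h (here refl)) (all⁺ f xs (h ∘ there))

  all-upTo⁻ : ∀ (f : ℕ → Bool) n → all f (upTo n) ≡ true → ∀ x → x < n → f x ≡ true
  all-upTo⁻ f n h x x<n = all⁻ f h (∈ₚ.∈-upTo⁺ x<n)

  all-upTo⁺ : ∀ (f : ℕ → Bool) n → (∀ x → x < n → f x ≡ true) → all f (upTo n) ≡ true
  all-upTo⁺ f n h = all⁺ f (upTo n) (λ x∈ → h _ (∈ₚ.∈-upTo⁻ x∈))

module Sums where

  open Booleans
  open import Data.Integer using (_+_; _*_; _-_)
  open import Relation.Nullary using (_⊎-dec_)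
  open import Algebra.Properties.CommutativeSemigroup ℤₚ.+-commutativeSemigroup using () renaming (interchange to +-interchange)

  χ : Bool → ℤ
  χ true  = + 1
  χ false = + 0

  δ : {P : Set} → Dec P → ℤ
  δ p? = χ (does p?)

  ∑ : List A → (A → ℤ) → ℤ
  ∑ []       f = + 0
  ∑ (x ∷ xs) f = f x + ∑ xs f

  infix 5 ∑
  syntax ∑ xs (λ x → e) = ∑[ x ∈ xs ] e

  δ-⇔ : {P Q : Set} (p? : Dec P) (q? : Dec Q) → (P → Q) → (Q → P) → δ p? ≡ δ q?
  δ-⇔ p? q? to from = cong χ (≡-by-≡true (λ p → dec-true q? (to (dec-witness p? p)))
                                         (λ q → dec-true p? (from (dec-witness q? q))))

  δ-⊎ : ∀ {P Q : Set} (p? : Dec P) (q? : Dec Q) → ¬ (P × Q) → δ (p? ⊎-dec q?) ≡ δ p? + δ q?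
  δ-⊎ (yes p) (yes q) ¬pq = ⊥-elim (¬pq (p , q))
  δ-⊎ (yes _) (no _)  _   = refl
  δ-⊎ (no _)  (yes _) _   = refl
  δ-⊎ (no _)  (no _)  _   = refl

  χ-∧ : ∀ a b → χ (a ∧ b) ≡ χ a * χ b
  χ-∧ true  b = sym (ℤₚ.*-identityˡ (χ b))
  χ-∧ false b = refl

  χ-*-cong : ∀ c {x y} → (c ≡ true → x ≡ y) → χ c * x ≡ χ c * y
  χ-*-cong true  x≡y = cong (+ 1 *_) (x≡y refl)
  χ-*-cong false {x} {y} _ = trans (ℤₚ.*-zeroˡ x) (sym (ℤₚ.*-zeroˡ y))

  χ-*-split : ∀ a b x → χ a * x ≡ χ (a ∧ b) * x + χ (a ∧ not b) * x
  χ-*-split true  true  x = sym (ℤₚ.+-identityʳ _)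
  χ-*-split true  false x = sym (ℤₚ.+-identityˡ _)
  χ-*-split false _     x = refl

  χ-*-zero : ∀ c {x} → (c ≡ true → x ≡ + 0) → χ c * x ≡ + 0
  χ-*-zero true  x≡0 = trans (ℤₚ.*-identityˡ _) (x≡0 refl)
  χ-*-zero false _   = refl

  χ-*-absorb : ∀ c d x → (d ≡ true → c ≡ true) → χ c * (χ d * x) ≡ χ d * x
  χ-*-absorb c false x _    = ℤₚ.*-zeroʳ (χ c)
  χ-*-absorb c true  x d⇒c rewrite d⇒c refl = ℤₚ.*-identityˡ _

  ∑-cong : ∀ (xs : List A) {f g : A → ℤ} → (∀ x → f x ≡ g x) → ∑ xs f ≡ ∑ xs g
  ∑-cong []       e = refl
  ∑-cong (x ∷ xs) e = cong₂ _+_ (e x) (∑-cong xs e)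

  ∑-zero : ∀ (xs : List A) {f : A → ℤ} → (∀ x → f x ≡ + 0) → ∑ xs f ≡ + 0
  ∑-zero []       e = refl
  ∑-zero (x ∷ xs) e = cong₂ _+_ (e x) (∑-zero xs e)

  ∑-distrib-+ : ∀ (xs : List A) (f g : A → ℤ) → ∑[ x ∈ xs ] (f x + g x) ≡ ∑ xs f + ∑ xs g
  ∑-distrib-+ []       f g = refl
  ∑-distrib-+ (x ∷ xs) f g rewrite ∑-distrib-+ xs f g = +-interchange (f x) (g x) (∑ xs f) (∑ xs g)

  ∑-*ˡ : ∀ (xs : List A) (c : ℤ) (f : A → ℤ) → ∑[ x ∈ xs ] (c * f x) ≡ c * ∑ xs f
  ∑-*ˡ []       c f = sym (ℤₚ.*-zeroʳ c)
  ∑-*ˡ (x ∷ xs) c f rewrite ∑-*ˡ xs c f = sym (ℤₚ.*-distribˡ-+ c (f x) (∑ xs f))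

  ∑-*ʳ : ∀ (xs : List A) (c : ℤ) (f : A → ℤ) → ∑[ x ∈ xs ] (f x * c) ≡ ∑ xs f * c
  ∑-*ʳ xs c f = begin
    ∑[ x ∈ xs ] (f x * c)  ≡⟨ ∑-cong xs (λ x → ℤₚ.*-comm (f x) c) ⟩
    ∑[ x ∈ xs ] (c * f x)  ≡⟨ ∑-*ˡ xs c f ⟩
    c * ∑ xs f             ≡⟨ ℤₚ.*-comm c (∑ xs f) ⟩
    ∑ xs f * c             ∎
    where open ≡-Reasoning

  ∑-neg : ∀ (xs : List A) (f : A → ℤ) → ∑[ x ∈ xs ] (- f x) ≡ - ∑ xs f
  ∑-neg []       f = refl
  ∑-neg (x ∷ xs) f rewrite ∑-neg xs f = sym (ℤₚ.neg-distrib-+ (f x) (∑ xs f))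

  ∑-distrib-- : ∀ (xs : List A) (f g : A → ℤ) → ∑[ x ∈ xs ] (f x - g x) ≡ ∑ xs f - ∑ xs g
  ∑-distrib-- xs f g = trans (∑-distrib-+ xs f (λ x → - g x)) (cong (_+_ (∑ xs f)) (∑-neg xs g))

  ∑-++ : ∀ (xs ys : List A) (f : A → ℤ) → ∑ (xs ++ ys) f ≡ ∑ xs f + ∑ ys f
  ∑-++ []       ys f = sym (ℤₚ.+-identityˡ _)
  ∑-++ (x ∷ xs) ys f rewrite ∑-++ xs ys f = sym (ℤₚ.+-assoc (f x) (∑ xs f) (∑ ys f))

  ∑-const : ∀ (xs : List A) (c : ℤ) → ∑[ _ ∈ xs ] c ≡ + length xs * c
  ∑-const []       c = sym (ℤₚ.*-zeroˡ c)
  ∑-const (x ∷ xs) c rewrite ∑-const xs c = begin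
    c + + length xs * c        ≡⟨ cong (_+ + length xs * c) (sym (ℤₚ.*-identityˡ c)) ⟩
    + 1 * c + + length xs * c  ≡⟨ sym (ℤₚ.*-distribʳ-+ c (+ 1) (+ length xs)) ⟩
    (+ 1 + + length xs) * c    ∎
    where open ≡-Reasoning

  length-filterᵇ : ∀ (p : A → Bool) (xs : List A) → + length (filterᵇ p xs) ≡ ∑[ x ∈ xs ] χ (p x)
  length-filterᵇ p []       = refl
  length-filterᵇ p (x ∷ xs) with p x
  ... | true  = cong (_+_ (+ 1)) (length-filterᵇ p xs)
  ... | false = trans (length-filterᵇ p xs) (sym (ℤₚ.+-identityˡ _))

  ∑-comm : ∀ (xs : List A) (ys : List B) (f : A → B → ℤ) →
           ∑[ x ∈ xs ] ∑[ y ∈ ys ] f x y ≡ ∑[ y ∈ ys ] ∑[ x ∈ xs ] f x y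
  ∑-comm []       ys f = sym (∑-zero ys (λ _ → refl))
  ∑-comm (x ∷ xs) ys f = begin
    ∑ ys (f x) + (∑[ x′ ∈ xs ] ∑ ys (f x′))         ≡⟨ cong (_+_ (∑ ys (f x))) (∑-comm xs ys f) ⟩
    ∑ ys (f x) + (∑[ y ∈ ys ] ∑[ x′ ∈ xs ] f x′ y)  ≡⟨ sym (∑-distrib-+ ys (f x) _) ⟩
    ∑[ y ∈ ys ] (f x y + (∑[ x′ ∈ xs ] f x′ y))     ∎
    where open ≡-Reasoning

  ∑∑-*ˡ : ∀ (xs : List A) (ys : List B) (c : ℤ) (f : A → B → ℤ) →
          ∑[ a ∈ xs ] ∑[ b ∈ ys ] (c * f a b) ≡ c * (∑[ a ∈ xs ] ∑[ b ∈ ys ] f a b)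
  ∑∑-*ˡ xs ys c f = trans (∑-cong xs (λ a → ∑-*ˡ ys c (f a))) (∑-*ˡ xs c (λ a → ∑ ys (f a)))

  ∑∑-*ʳ : ∀ (xs : List A) (ys : List B) (c : ℤ) (f : A → B → ℤ) →
          ∑[ a ∈ xs ] ∑[ b ∈ ys ] (f a b * c) ≡ (∑[ a ∈ xs ] ∑[ b ∈ ys ] f a b) * c
  ∑∑-*ʳ xs ys c f = trans (∑-cong xs (λ a → ∑-*ʳ ys c (f a))) (∑-*ʳ xs c (λ a → ∑ ys (f a)))

  ∑⁴-reorder : ∀ (xs : List A) (f : A → A → A → A → ℤ) →
               ∑[ d ∈ xs ] ∑[ e ∈ xs ] ∑[ a ∈ xs ] ∑[ b ∈ xs ] f d e a b
               ≡ ∑[ a ∈ xs ] ∑[ d ∈ xs ] ∑[ b ∈ xs ] ∑[ e ∈ xs ] f d e a b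
  ∑⁴-reorder xs f = trans (∑-cong xs (λ d → trans (∑-comm xs xs (λ e a → ∑[ b ∈ xs ] f d e a b))
                                                   (∑-cong xs (λ a → ∑-comm xs xs (λ e b → f d e a b)))))
                          (∑-comm xs xs (λ d a → ∑[ b ∈ xs ] ∑[ e ∈ xs ] f d e a b))

  ∑-map : ∀ (h : A → B) (xs : List A) (f : B → ℤ) → ∑ (map h xs) f ≡ ∑ xs (f ∘ h)
  ∑-map h []       f = refl
  ∑-map h (x ∷ xs) f = cong (_+_ (f (h x))) (∑-map h xs f)

  ∑-concatMap : ∀ (h : A → List B) (xs : List A) (f : B → ℤ) →
                ∑ (concatMap h xs) f ≡ ∑[ x ∈ xs ] ∑ (h x) f
  ∑-concatMap h []       f = refl
  ∑-concatMap h (x ∷ xs) f = trans (∑-++ (h x) (concatMap h xs) f) (cong (_+_ (∑ (h x) f)) (∑-concatMap h xs f))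

  ∑-upTo-suc : ∀ n (f : ℕ → ℤ) → ∑ (upTo (suc n)) f ≡ ∑ (upTo n) f + f n
  ∑-upTo-suc n f = begin
    ∑ (upTo (suc n)) f          ≡⟨ cong (λ l → ∑ l f) (sym (Listₚ.upTo-∷ʳ n)) ⟩
    ∑ (upTo n ++ n ∷ []) f      ≡⟨ ∑-++ (upTo n) (n ∷ []) f ⟩
    ∑ (upTo n) f + (f n + + 0)  ≡⟨ cong (_+_ (∑ (upTo n) f)) (ℤₚ.+-identityʳ (f n)) ⟩
    ∑ (upTo n) f + f n          ∎
    where open ≡-Reasoning

  ∑-upTo-cong : ∀ n {f g : ℕ → ℤ} → (∀ x → x < n → f x ≡ g x) → ∑ (upTo n) f ≡ ∑ (upTo n) g
  ∑-upTo-cong zero    e = refl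
  ∑-upTo-cong (suc n) {f} {g} e = begin
    ∑ (upTo (suc n)) f  ≡⟨ ∑-upTo-suc n f ⟩
    ∑ (upTo n) f + f n  ≡⟨ cong₂ _+_ (∑-upTo-cong n (λ x x<n → e x (ℕₚ.m<n⇒m<1+n x<n))) (e n ℕₚ.≤-refl) ⟩
    ∑ (upTo n) g + g n  ≡⟨ sym (∑-upTo-suc n g) ⟩
    ∑ (upTo (suc n)) g  ∎
    where open ≡-Reasoning

  ∑-upTo-extend : ∀ m n {f : ℕ → ℤ} → m ≤ n → (∀ x → m ≤ x → x < n → f x ≡ + 0) →
                  ∑ (upTo n) f ≡ ∑ (upTo m) f
  ∑-upTo-extend m zero    z≤n   _ = refl
  ∑-upTo-extend m (suc n) {f} m≤1+n e with ℕₚ.m≤n⇒m<n∨m≡n m≤1+n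
  ... | inj₂ refl      = refl
  ... | inj₁ (s≤s m≤n) = begin
    ∑ (upTo (suc n)) f  ≡⟨ ∑-upTo-suc n f ⟩
    ∑ (upTo n) f + f n  ≡⟨ cong₂ _+_ (∑-upTo-extend m n m≤n (λ x m≤x x<n → e x m≤x (ℕₚ.m<n⇒m<1+n x<n)))
                                     (e n m≤n ℕₚ.≤-refl) ⟩
    ∑ (upTo m) f + + 0  ≡⟨ ℤₚ.+-identityʳ _ ⟩
    ∑ (upTo m) f        ∎
    where open ≡-Reasoning

module Enumerations where

  open Booleans
  open Sums
  open import Data.Integer using (_+_; _*_)

  record Enumerates (_≟_ : DecidableEquality A) (xs : List A) (P : A → Bool) : Set where
    constructor enumerates
    field
      multiplicity : ∀ a → ∑[ b ∈ xs ] δ (a ≟ b) ≡ χ (P a)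

  open Enumerates public

  Complete : DecidableEquality A → List A → Set
  Complete _≟_ xs = Enumerates _≟_ xs (λ _ → true)

  ∑-δ : ∀ {_≟_ : DecidableEquality A} {xs P} → Enumerates _≟_ xs P →
        ∀ a (F : A → ℤ) → ∑[ b ∈ xs ] (δ (a ≟ b) * F b) ≡ χ (P a) * F a
  ∑-δ {_≟_ = _≟_} {xs} {P} en a F = begin
    ∑[ b ∈ xs ] (δ (a ≟ b) * F b)  ≡⟨ ∑-cong xs move ⟩
    ∑[ b ∈ xs ] (δ (a ≟ b) * F a)  ≡⟨ ∑-*ʳ xs (F a) _ ⟩
    (∑[ b ∈ xs ] δ (a ≟ b)) * F a  ≡⟨ cong (_* F a) (multiplicity en a) ⟩
    χ (P a) * F a                  ∎
    where
    open ≡-Reasoning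
    move : ∀ b → δ (a ≟ b) * F b ≡ δ (a ≟ b) * F a
    move b = χ-*-cong (does (a ≟ b)) (λ eq → cong F (sym (dec-witness (a ≟ b) eq)))

  ∑-δ-∧ : ∀ {_≟_ : DecidableEquality A} {xs P} → Enumerates _≟_ xs P →
            ∀ a c (v : ℤ) → (c ≡ true → P a ≡ true) → ∑[ b ∈ xs ] (χ (c ∧ does (a ≟ b)) * v) ≡ χ c * v
  ∑-δ-∧ {_≟_ = _≟_} {xs} {P} en a c v c⇒P = begin
    ∑[ b ∈ xs ] (χ (c ∧ does (a ≟ b)) * v)  ≡⟨ ∑-cong xs swap ⟩
    ∑[ b ∈ xs ] (δ (a ≟ b) * (χ c * v))     ≡⟨ ∑-δ en a (λ _ → χ c * v) ⟩
    χ (P a) * (χ c * v)                     ≡⟨ χ-*-absorb (P a) c v c⇒P ⟩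
    χ c * v                                 ∎
    where
    open ≡-Reasoning
    swap : ∀ b → χ (c ∧ does (a ≟ b)) * v ≡ δ (a ≟ b) * (χ c * v)
    swap b = begin
      χ (c ∧ does (a ≟ b)) * v  ≡⟨ cong (_* v) (χ-∧ c (does (a ≟ b))) ⟩
      χ c * δ (a ≟ b) * v       ≡⟨ cong (_* v) (ℤₚ.*-comm (χ c) (δ (a ≟ b))) ⟩
      δ (a ≟ b) * χ c * v       ≡⟨ ℤₚ.*-assoc (δ (a ≟ b)) (χ c) v ⟩
      δ (a ≟ b) * (χ c * v)     ∎

  record SubsetBijection (P : A → Bool) (Q : B → Bool) : Set where
    field
      to      : A → B
      from    : B → A
      to-∈    : ∀ {a} → P a ≡ true → Q (to a) ≡ true
      from-∈  : ∀ {b} → Q b ≡ true → P (from b) ≡ true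
      from∘to : ∀ {a} → P a ≡ true → from (to a) ≡ a
      to∘from : ∀ {b} → Q b ≡ true → to (from b) ≡ b

  ∑-reindex : ∀ {_≟A_ : DecidableEquality A} {_≟B_ : DecidableEquality B} {xs ys memA memB P Q} →
              Enumerates _≟A_ xs memA → Enumerates _≟B_ ys memB →
              (∀ {a} → P a ≡ true → memA a ≡ true) → (∀ {b} → Q b ≡ true → memB b ≡ true) →
              (φ : SubsetBijection P Q) (w : A → ℤ) →
              ∑[ a ∈ xs ] (χ (P a) * w a) ≡ ∑[ b ∈ ys ] (χ (Q b) * w (SubsetBijection.from φ b))
  ∑-reindex {A = A} {B = B} {_≟A_ = _≟A_} {_≟B_} {xs} {ys} {P = P} {Q} enA enB P⊆memA Q⊆memB φ w = begin
    ∑[ a ∈ xs ] (χ (P a) * w a)                             ≡⟨ ∑-cong xs (λ a → sym (∑-δ-∧ enB (to a) (P a) (w a) (Q⊆memB ∘ to-∈))) ⟩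
    ∑[ a ∈ xs ] ∑[ b ∈ ys ] (χ (graph a b) * w a)           ≡⟨ ∑-cong xs (λ a → ∑-cong ys (λ b → on-graph a b)) ⟩
    ∑[ a ∈ xs ] ∑[ b ∈ ys ] (χ (graph⁻¹ a b) * w (from b))  ≡⟨ ∑-comm xs ys _ ⟩
    ∑[ b ∈ ys ] ∑[ a ∈ xs ] (χ (graph⁻¹ a b) * w (from b))  ≡⟨ ∑-cong ys (λ b → ∑-δ-∧ enA (from b) (Q b) (w (from b)) (P⊆memA ∘ from-∈)) ⟩
    ∑[ b ∈ ys ] (χ (Q b) * w (from b))                      ∎
    where
    open ≡-Reasoning
    open SubsetBijection φ
    graph graph⁻¹ : A → B → Bool
    graph    a b = P a ∧ does (to a ≟B b)
    graph⁻¹  a b = Q b ∧ does (from b ≟A a)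
    graph≡graph⁻¹ : ∀ a b → graph a b ≡ graph⁻¹ a b
    graph≡graph⁻¹ a b = ≡-by-≡true fwd bwd
      where
      fwd : graph a b ≡ true → graph⁻¹ a b ≡ true
      fwd h with ∧-elim h
      ... | Pa , eq with refl ← dec-witness (to a ≟B b) eq = ∧-intro (to-∈ Pa) (dec-true (from (to a) ≟A a) (from∘to Pa))
      bwd : graph⁻¹ a b ≡ true → graph a b ≡ true
      bwd h with ∧-elim h
      ... | Qb , eq with refl ← dec-witness (from b ≟A a) eq = ∧-intro (from-∈ Qb) (dec-true (to (from b) ≟B b) (to∘from Qb))
    on-graph : ∀ a b → χ (graph a b) * w a ≡ χ (graph⁻¹ a b) * w (from b)
    on-graph a b rewrite graph≡graph⁻¹ a b =
      χ-*-cong (graph⁻¹ a b) (λ h → cong w (sym (dec-witness (from b ≟A a) (proj₂ (∧-elim h)))))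

  enumerates-upTo : ∀ n → Enumerates _≟_ (upTo n) (λ a → does (a <? n))
  enumerates-upTo zero    = enumerates (λ _ → refl)
  enumerates-upTo (suc n) = enumerates λ a → begin
    ∑[ b ∈ upTo (suc n) ] δ (a ≟ b)          ≡⟨ ∑-upTo-suc n _ ⟩
    (∑[ b ∈ upTo n ] δ (a ≟ b)) + δ (a ≟ n)  ≡⟨ cong (_+ δ (a ≟ n)) (multiplicity (enumerates-upTo n) a) ⟩
    χ (does (a <? n)) + δ (a ≟ n)            ≡⟨ add-last a ⟩
    χ (does (a <? suc n))                    ∎
    where
    open ≡-Reasoning
    add-last : ∀ a → χ (does (a <? n)) + δ (a ≟ n) ≡ χ (does (a <? suc n))
    add-last a with ℕₚ.<-cmp a n
    ... | tri< a<n a≢n _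
      rewrite dec-true (a <? n) a<n | dec-false (a ≟ n) a≢n | dec-true (a <? suc n) (ℕₚ.m<n⇒m<1+n a<n) = refl
    ... | tri≈ _ refl _
      rewrite dec-false (a <? a) (ℕₚ.<-irrefl refl) | dec-true (a ≟ a) refl | dec-true (a <? suc a) ℕₚ.≤-refl = refl
    ... | tri> _ a≢n n<a
      rewrite dec-false (a <? n) (ℕₚ.<-asym n<a) | dec-false (a ≟ n) a≢n
            | dec-false (a <? suc n) (ℕₚ.<⇒≱ n<a ∘ ℕₚ.≤-pred) = refl

  ∑-reindex-χ : ∀ {_≟A_ : DecidableEquality A} {_≟B_ : DecidableEquality B} {xs ys memA memB P Q} →
                Enumerates _≟A_ xs memA → Enumerates _≟B_ ys memB →
                (∀ {a} → P a ≡ true → memA a ≡ true) → (∀ {b} → Q b ≡ true → memB b ≡ true) →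
                SubsetBijection P Q → ∑[ a ∈ xs ] χ (P a) ≡ ∑[ b ∈ ys ] χ (Q b)
  ∑-reindex-χ {xs = xs} {ys} {P = P} {Q} enA enB P⊆memA Q⊆memB φ = begin
    ∑[ a ∈ xs ] χ (P a)          ≡⟨ ∑-cong xs (λ a → sym (ℤₚ.*-identityʳ (χ (P a)))) ⟩
    ∑[ a ∈ xs ] (χ (P a) * + 1)  ≡⟨ ∑-reindex enA enB P⊆memA Q⊆memB φ (λ _ → + 1) ⟩
    ∑[ b ∈ ys ] (χ (Q b) * + 1)  ≡⟨ ∑-cong ys (λ b → ℤₚ.*-identityʳ (χ (Q b))) ⟩
    ∑[ b ∈ ys ] χ (Q b)          ∎
    where open ≡-Reasoning

  ∑-allFin-suc : ∀ n (f : Fin (suc n) → ℤ) → ∑ (allFin (suc n)) f ≡ f fzero + (∑[ b ∈ allFin n ] f (fsuc b))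
  ∑-allFin-suc n f =
    cong (_+_ (f fzero)) (trans (cong (λ l → ∑ l f) (sym (Listₚ.map-tabulate {n = n} (λ i → i) fsuc))) (∑-map fsuc (allFin n) f))

  enumerates-allFin : ∀ n → Complete Finₚ._≟_ (allFin n)
  enumerates-allFin n = enumerates (once n)
    where
    once : ∀ n (a : Fin n) → ∑[ b ∈ allFin n ] δ (a Finₚ.≟ b) ≡ + 1
    once (suc n) fzero = begin
      ∑[ b ∈ allFin (suc n) ] δ (fzero Finₚ.≟ b)         ≡⟨ ∑-allFin-suc n (λ b → δ (fzero Finₚ.≟ b)) ⟩
      + 1 + (∑[ b ∈ allFin n ] δ (fzero Finₚ.≟ fsuc b))  ≡⟨ cong (_+_ (+ 1)) (∑-zero (allFin n) (λ _ → refl)) ⟩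
      + 1                                                ∎
      where open ≡-Reasoning
    once (suc n) (fsuc a) = begin
      ∑[ b ∈ allFin (suc n) ] δ (fsuc a Finₚ.≟ b)
        ≡⟨ ∑-allFin-suc n (λ b → δ (fsuc a Finₚ.≟ b)) ⟩
      + 0 + (∑[ b ∈ allFin n ] δ (fsuc a Finₚ.≟ fsuc b))
        ≡⟨ ℤₚ.+-identityˡ _ ⟩
      ∑[ b ∈ allFin n ] δ (fsuc a Finₚ.≟ fsuc b)
        ≡⟨ ∑-cong (allFin n) (λ b → δ-⇔ (fsuc a Finₚ.≟ fsuc b) (a Finₚ.≟ b) Finₚ.suc-injective (cong fsuc)) ⟩
      ∑[ b ∈ allFin n ] δ (a Finₚ.≟ b)
        ≡⟨ once n a ⟩
      + 1 ∎
      where open ≡-Reasoning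

  enumerates-product : ∀ {_≟A_ : DecidableEquality A} {_≟B_ : DecidableEquality B} {_≟C_ : DecidableEquality C}
                         {xs ys} (h : A → B → C) →
                       Complete _≟A_ xs → Complete _≟B_ ys →
                       (∀ {a b a′ b′} → h a b ≡ h a′ b′ → a ≡ a′ × b ≡ b′) → (∀ c → Σ[ a ∈ A ] Σ[ b ∈ B ] h a b ≡ c) →
                       Complete _≟C_ (concatMap (λ a → map (h a) ys) xs)
  enumerates-product {A = A} {_≟A_ = _≟A_} {_≟B_} {_≟C_} {xs} {ys} h enA enB h-injective h-surjective =
    enumerates once
    where
    once : ∀ c → ∑[ c′ ∈ concatMap (λ a → map (h a) ys) xs ] δ (c ≟C c′) ≡ + 1
    once c with h-surjective c
    ... | a , b , refl = begin
      ∑[ c′ ∈ concatMap (λ a′ → map (h a′) ys) xs ] δ (h a b ≟C c′)  ≡⟨ ∑-concatMap _ xs _ ⟩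
      ∑[ a′ ∈ xs ] ∑[ c′ ∈ map (h a′) ys ] δ (h a b ≟C c′)           ≡⟨ ∑-cong xs (λ a′ → ∑-map (h a′) ys _) ⟩
      ∑[ a′ ∈ xs ] ∑[ b′ ∈ ys ] δ (h a b ≟C h a′ b′)                 ≡⟨ ∑-cong xs (λ a′ → ∑-cong ys (λ b′ → split a′ b′)) ⟩
      ∑[ a′ ∈ xs ] ∑[ b′ ∈ ys ] (δ (a ≟A a′) * δ (b ≟B b′))          ≡⟨ ∑-cong xs (λ a′ → ∑-*ˡ ys (δ (a ≟A a′)) _) ⟩
      ∑[ a′ ∈ xs ] (δ (a ≟A a′) * (∑[ b′ ∈ ys ] δ (b ≟B b′)))        ≡⟨ ∑-cong xs (λ a′ → cong (δ (a ≟A a′) *_) (multiplicity enB b)) ⟩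
      ∑[ a′ ∈ xs ] (δ (a ≟A a′) * + 1)                               ≡⟨ ∑-cong xs (λ a′ → ℤₚ.*-identityʳ _) ⟩
      ∑[ a′ ∈ xs ] δ (a ≟A a′)                                       ≡⟨ multiplicity enA a ⟩
      + 1                                                            ∎
      where
      open ≡-Reasoning
      split : ∀ a′ b′ → δ (h a b ≟C h a′ b′) ≡ δ (a ≟A a′) * δ (b ≟B b′)
      split a′ b′ = trans (δ-⇔ (h a b ≟C h a′ b′) (a ≟A a′ ×-dec b ≟B b′) h-injective (λ { (refl , refl) → refl }))
                          (χ-∧ (does (a ≟A a′)) (does (b ≟B b′)))

  vectors : List A → (k : ℕ) → List (Vec A k)
  vectors xs zero    = [] ∷ []
  vectors xs (suc k) = concatMap (λ x → map (x ∷_) (vectors xs k)) xs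

  enumerates-vectors : ∀ {_≟_ : DecidableEquality A} {xs} → Complete _≟_ xs → ∀ k → Complete (Vecₚ.≡-dec _≟_) (vectors xs k)
  enumerates-vectors en zero    = enumerates λ { [] → refl }
  enumerates-vectors en (suc k) =
    enumerates-product _∷_ en (enumerates-vectors en k) Vecₚ.∷-injective (λ { (x ∷ v) → x , v , refl })

  pairs : List A → List B → List (A × B)
  pairs xs ys = concatMap (λ a → map (a ,_) ys) xs

  enumerates-pairs : ∀ {_≟A_ : DecidableEquality A} {_≟B_ : DecidableEquality B} {xs ys} →
                     Complete _≟A_ xs → Complete _≟B_ ys → Complete (Productₚ.≡-dec _≟A_ _≟B_) (pairs xs ys)
  enumerates-pairs enA enB = enumerates-product _,_ enA enB Productₚ.,-injective (λ { (a , b) → a , b , refl })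

  ∑-pairs : ∀ (xs : List A) (ys : List B) (f : A × B → ℤ) → ∑ (pairs xs ys) f ≡ ∑[ a ∈ xs ] ∑[ b ∈ ys ] f (a , b)
  ∑-pairs xs ys f = trans (∑-concatMap _ xs f) (∑-cong xs (λ a → ∑-map (a ,_) ys f))

  ∑-pairs-proj₁ : ∀ (xs : List A) (ys : List B) (f : A → ℤ) → ∑[ q ∈ pairs xs ys ] f (proj₁ q) ≡ + length ys * ∑ xs f
  ∑-pairs-proj₁ xs ys f = begin
    ∑[ q ∈ pairs xs ys ] f (proj₁ q)    ≡⟨ ∑-pairs xs ys (f ∘ proj₁) ⟩
    ∑[ a ∈ xs ] ∑[ _ ∈ ys ] f a         ≡⟨ ∑-cong xs (λ a → ∑-const ys (f a)) ⟩
    ∑[ a ∈ xs ] (+ length ys * f a)     ≡⟨ ∑-*ˡ xs (+ length ys) f ⟩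
    + length ys * ∑ xs f                ∎
    where open ≡-Reasoning

module MöbiusFunction where

  open Booleans
  open Sums
  open Enumerations
  open import Data.Nat using (_*_; NonZero; ≢-nonZero⁻¹)
  open import Data.Nat.Divisibility
  open import Data.Nat.Primality using (Prime; prime?; ¬prime[1]; euclidsLemma; prime⇒irreducible; prime⇒nonZero)
  open import Data.Nat.Primality.Factorisation using (factorise)
  open import Data.Nat.ListAction using (product)
  open import Data.Nat.DivMod using (_/_; m*[n/m]≡n; m*n/n≡m)
  import Data.List.Relation.Unary.All as All
  open import Data.Integer using () renaming (_+_ to _+ℤ_; _*_ to _*ℤ_)
  open import Relation.Nullary using (_⊎-dec_)

  SquareFree : ℕ → Set
  SquareFree x = ∀ {q} → Prime q → ¬ (q * q ∣ x)

  isPrimeDivisorOf : ℕ → ℕ → Bool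
  isPrimeDivisorOf y q = does (prime? q ×-dec q ∣? y)

  ∈-primeDivisors : ∀ {x q} .{{_ : NonZero x}} → Prime q → q ∣ x → q ∈ primeDivisors x
  ∈-primeDivisors {x} {q} q-prime q∣x = ∈ₚ.∈-filter⁺ (T? ∘ isPrimeDivisorOf x) (∈ₚ.∈-upTo⁺ (s≤s (∣⇒≤ q∣x)))
    (Equivalence.from Boolₚ.T-≡ (dec-true (prime? q ×-dec q ∣? x) (q-prime , q∣x)))

  ∈-primeDivisors⁻ : ∀ {x q} → q ∈ primeDivisors x → Prime q × q ∣ x
  ∈-primeDivisors⁻ {x} {q} q∈ =
    dec-witness (prime? q ×-dec q ∣? x) (Equivalence.to Boolₚ.T-≡ (proj₂ (∈ₚ.∈-filter⁻ (T? ∘ isPrimeDivisorOf x) {xs = upTo (suc x)} q∈)))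

  squarefree⇒SquareFree : ∀ {x} .{{_ : NonZero x}} → squarefree x ≡ true → SquareFree x
  squarefree⇒SquareFree {x} sf {q} q-prime qq∣x =
    false≢true (trans (cong not (sym (dec-true (q * q ∣? x) qq∣x)))
                      (all⁻ _ {primeDivisors x} sf (∈-primeDivisors q-prime (m*n∣⇒m∣ q q qq∣x))))

  SquareFree⇒squarefree : ∀ {x} → SquareFree x → squarefree x ≡ true
  SquareFree⇒squarefree {x} sf = all⁺ _ (primeDivisors x)
    (λ {q} q∈ → cong not (dec-false (q * q ∣? x) (sf (proj₁ (∈-primeDivisors⁻ {x} q∈)))))

  prime∣prime⇒≡ : ∀ {p q} → Prime p → Prime q → q ∣ p → q ≡ p
  prime∣prime⇒≡ p-prime q-prime q∣p with prime⇒irreducible p-prime q∣p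
  ... | inj₁ refl = ⊥-elim (¬prime[1] q-prime)
  ... | inj₂ q≡p  = q≡p

  squareFree-*⁻ : ∀ p {x} → SquareFree (p * x) → SquareFree x
  squareFree-*⁻ p sf q-prime qq∣x = sf q-prime (∣n⇒∣m*n p qq∣x)

  squareFree-* : ∀ {p x} → Prime p → ¬ p ∣ x → SquareFree x → SquareFree (p * x)
  squareFree-* {p} {x} p-prime p∤x sf {q} q-prime qq∣px
    with euclidsLemma p x q-prime (m*n∣⇒m∣ q q qq∣px)
  ... | inj₁ q∣p with refl ← prime∣prime⇒≡ p-prime q-prime q∣p =
    p∤x (*-cancelˡ-∣ p {{prime⇒nonZero p-prime}} qq∣px)
  ... | inj₂ (divides a refl) with euclidsLemma p a q-prime q∣pa
    where
    q∣pa : q ∣ p * a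
    q∣pa = *-cancelʳ-∣ q {{prime⇒nonZero q-prime}} (subst (q * q ∣_) (sym (ℕₚ.*-assoc p a q)) qq∣px)
  ... | inj₁ q∣p with refl ← prime∣prime⇒≡ p-prime q-prime q∣p = p∤x (n∣m*n a)
  ... | inj₂ q∣a = sf q-prime (*-monoˡ-∣ q q∣a)

  μ-squareful : ∀ {p x} .{{_ : NonZero x}} → Prime p → p * p ∣ x → μ x ≡ + 0
  μ-squareful {p} {x} p-prime pp∣x with squarefree x in sf
  ... | true  = ⊥-elim (squarefree⇒SquareFree sf p-prime pp∣x)
  ... | false = refl

  primeDivisor-* : ∀ {p x q} → Prime p → ¬ p ∣ x → (Prime q × q ∣ p * x) → (Prime q × q ∣ x) ⊎ p ≡ q
  primeDivisor-* {p} {x} p-prime p∤x (q-prime , q∣px) with euclidsLemma p x q-prime q∣px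
  ... | inj₁ q∣p = inj₂ (sym (prime∣prime⇒≡ p-prime q-prime q∣p))
  ... | inj₂ q∣x = inj₁ (q-prime , q∣x)

  primeDivisor-*⁻ : ∀ {p x q} → Prime p → (Prime q × q ∣ x) ⊎ p ≡ q → Prime q × q ∣ p * x
  primeDivisor-*⁻ {p} {x} p-prime (inj₁ (q-prime , q∣x)) = q-prime , ∣n⇒∣m*n p q∣x
  primeDivisor-*⁻ {p} {x} p-prime (inj₂ refl)            = p-prime , m∣m*n x

  length-primeDivisors-* : ∀ {p x} .{{_ : NonZero x}} → Prime p → ¬ p ∣ x →
                           length (primeDivisors (p * x)) ≡ suc (length (primeDivisors x))
  length-primeDivisors-* {p} {x} p-prime p∤x = ℤₚ.+-injective (begin
    + length (primeDivisors (p * x))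
      ≡⟨ length-filterᵇ (isPrimeDivisorOf (p * x)) (upTo (suc (p * x))) ⟩
    ∑[ q ∈ upTo (suc (p * x)) ] χ (isPrimeDivisorOf (p * x) q)
      ≡⟨ ∑-cong (upTo (suc (p * x))) split ⟩
    ∑[ q ∈ upTo (suc (p * x)) ] (χ (isPrimeDivisorOf x q) +ℤ δ (p ≟ q))
      ≡⟨ ∑-distrib-+ (upTo (suc (p * x))) (χ ∘ isPrimeDivisorOf x) (λ q → δ (p ≟ q)) ⟩
    (∑[ q ∈ upTo (suc (p * x)) ] χ (isPrimeDivisorOf x q)) +ℤ (∑[ q ∈ upTo (suc (p * x)) ] δ (p ≟ q))
      ≡⟨ cong₂ _+ℤ_ shrink count-p ⟩
    (∑[ q ∈ upTo (suc x) ] χ (isPrimeDivisorOf x q)) +ℤ + 1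
      ≡⟨ cong (_+ℤ + 1) (sym (length-filterᵇ (isPrimeDivisorOf x) (upTo (suc x)))) ⟩
    + length (primeDivisors x) +ℤ + 1
      ≡⟨ cong +_ (ℕₚ.+-comm (length (primeDivisors x)) 1) ⟩
    + suc (length (primeDivisors x)) ∎)
    where
    open ≡-Reasoning
    instance
      p≢0 : NonZero p
      p≢0 = prime⇒nonZero p-prime
    split : ∀ q → χ (isPrimeDivisorOf (p * x) q) ≡ χ (isPrimeDivisorOf x q) +ℤ δ (p ≟ q)
    split q = trans (δ-⇔ (prime? q ×-dec q ∣? p * x) ((prime? q ×-dec q ∣? x) ⊎-dec (p ≟ q))
                         (primeDivisor-* p-prime p∤x) (primeDivisor-*⁻ p-prime))
                    (δ-⊎ (prime? q ×-dec q ∣? x) (p ≟ q) (λ { ((_ , p∣x) , refl) → p∤x p∣x }))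
    shrink : ∑[ q ∈ upTo (suc (p * x)) ] χ (isPrimeDivisorOf x q) ≡ ∑[ q ∈ upTo (suc x) ] χ (isPrimeDivisorOf x q)
    shrink = ∑-upTo-extend (suc x) (suc (p * x)) (s≤s (ℕₚ.m≤n*m x p))
      (λ q x<q _ → cong χ (dec-false (prime? q ×-dec q ∣? x) (λ (_ , q∣x) → ℕₚ.<⇒≱ x<q (∣⇒≤ q∣x))))
    count-p : ∑[ q ∈ upTo (suc (p * x)) ] δ (p ≟ q) ≡ + 1
    count-p = begin
      ∑[ q ∈ upTo (suc (p * x)) ] δ (p ≟ q)           ≡⟨ ∑-cong (upTo (suc (p * x))) (λ q → sym (ℤₚ.*-identityʳ (δ (p ≟ q)))) ⟩
      ∑[ q ∈ upTo (suc (p * x)) ] (δ (p ≟ q) *ℤ + 1)  ≡⟨ ∑-δ (enumerates-upTo (suc (p * x))) p (λ _ → + 1) ⟩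
      χ (does (p <? suc (p * x))) *ℤ + 1              ≡⟨ cong (λ b → χ b *ℤ + 1) (dec-true (p <? suc (p * x)) (s≤s (ℕₚ.m≤m*n p x))) ⟩
      + 1                                             ∎

  μ-extra-prime : ∀ d d′ → squarefree d ≡ squarefree d′ →
                  length (primeDivisors d) ≡ suc (length (primeDivisors d′)) → μ d ≡ - μ d′
  μ-extra-prime d d′ same-sf one-more
    with squarefree d | squarefree d′ | length (primeDivisors d) | length (primeDivisors d′)
  μ-extra-prime d d′ refl refl | true  | true  | _ | _ = refl
  μ-extra-prime d d′ refl refl | false | false | _ | _ = refl

  μ-* : ∀ {p x} .{{_ : NonZero x}} → Prime p → ¬ p ∣ x → μ (p * x) ≡ - μ x
  μ-* {p} {x} p-prime p∤x = μ-extra-prime (p * x) x same-squarefree (length-primeDivisors-* p-prime p∤x)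
    where
    instance
      px≢0 : NonZero (p * x)
      px≢0 = ℕₚ.m*n≢0 p x {{prime⇒nonZero p-prime}}
    same-squarefree : squarefree (p * x) ≡ squarefree x
    same-squarefree = ≡-by-≡true
      (λ sf → SquareFree⇒squarefree (squareFree-*⁻ p (squarefree⇒SquareFree sf)))
      (λ sf → SquareFree⇒squarefree (squareFree-* p-prime p∤x (squarefree⇒SquareFree sf)))

  prime-factor : ∀ {c} → 2 ≤ c → Σ[ p ∈ ℕ ] Prime p × p ∣ c
  prime-factor {suc (suc c)} _ with factorise (suc (suc c))
  ... | record { factors = [] ; isFactorisation = () }
  ... | record { factors = p ∷ ps ; isFactorisation = eq ; factorsPrime = p-prime All.∷ _ } =
    p , p-prime , divides (product ps) (trans eq (ℕₚ.*-comm p (product ps)))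
  prime-factor {suc zero} (s≤s ())

  nonZero-divisor : ∀ {c d} .{{_ : NonZero c}} → d ∣ c → NonZero d
  nonZero-divisor {c} {zero}  0∣c = ⊥-elim (≢-nonZero⁻¹ c (0∣⇒≡0 0∣c))
  nonZero-divisor {c} {suc _} _   = _

  prime*coprime-∣ : ∀ {p c d} → Prime p → p ∣ c → ¬ p ∣ d → d ∣ c → p * d ∣ c
  prime*coprime-∣ {p} {c} {d} p-prime p∣c p∤d (divides a c≡ad) with euclidsLemma a d p-prime (subst (p ∣_) c≡ad p∣c)
  ... | inj₁ (divides b refl) = divides b (trans c≡ad (ℕₚ.*-assoc b p d))
  ... | inj₂ p∣d             = ⊥-elim (p∤d p∣d)

  module _ {c N p : ℕ} .{{_ : NonZero c}} (c≤N : c ≤ N) (p-prime : Prime p) (p∣c : p ∣ c) where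

    private
      instance
        p≢0 : NonZero p
        p≢0 = prime⇒nonZero p-prime
      L = upTo (suc N)

    divisor-with-p divisor-without-p : ℕ → Bool
    divisor-with-p    d = does (d ∣? c) ∧ does (p ∣? d)
    divisor-without-p d = does (d ∣? c) ∧ not (does (p ∣? d))

    divide-by-p : SubsetBijection divisor-with-p (λ d → does (p * d ∣? c))
    divide-by-p = record
      { to      = _/ p
      ; from    = p *_
      ; to-∈    = λ {d} h → let (d∣c , p∣d) = ∧-elim h in
                    dec-true (p * (d / p) ∣? c) (subst (_∣ c) (sym (m*[n/m]≡n (dec-witness (p ∣? d) p∣d))) (dec-witness (d ∣? c) d∣c))
      ; from-∈  = λ {d} h → ∧-intro h (dec-true (p ∣? p * d) (m∣m*n d))
      ; from∘to = λ {d} h → m*[n/m]≡n (dec-witness (p ∣? d) (proj₂ (∧-elim {does (d ∣? c)} h)))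
      ; to∘from = λ {d} _ → trans (cong (_/ p) (ℕₚ.*-comm p d)) (m*n/n≡m d p)
      }

    μ-pair-off : ∀ d → χ (does (p * d ∣? c)) *ℤ μ (p * d) ≡ - (χ (divisor-without-p d) *ℤ μ d)
    μ-pair-off d with p ∣? d
    ... | yes p∣d = trans (χ-*-zero (does (p * d ∣? c)) squareful)
                          (sym (cong -_ (trans (cong (λ b → χ b *ℤ μ d) (Boolₚ.∧-zeroʳ (does (d ∣? c)))) (ℤₚ.*-zeroˡ (μ d)))))
      where
      squareful : does (p * d ∣? c) ≡ true → μ (p * d) ≡ + 0
      squareful h = μ-squareful {{nonZero-divisor (dec-witness (p * d ∣? c) h)}} p-prime (*-monoʳ-∣ p p∣d)
    ... | no p∤d = begin
      χ (does (p * d ∣? c)) *ℤ μ (p * d)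
        ≡⟨ cong (_*ℤ μ (p * d)) (δ-⇔ (p * d ∣? c) (d ∣? c) (m*n∣⇒n∣ p d) (prime*coprime-∣ p-prime p∣c p∤d)) ⟩
      δ (d ∣? c) *ℤ μ (p * d)
        ≡⟨ χ-*-cong (does (d ∣? c)) (λ h → μ-* {{nonZero-divisor (dec-witness (d ∣? c) h)}} p-prime p∤d) ⟩
      δ (d ∣? c) *ℤ - μ d
        ≡⟨ sym (ℤₚ.neg-distribʳ-* (δ (d ∣? c)) (μ d)) ⟩
      - (δ (d ∣? c) *ℤ μ d)
        ≡⟨ cong (λ b → - (χ b *ℤ μ d)) (sym (Boolₚ.∧-identityʳ (does (d ∣? c)))) ⟩
      - (χ (does (d ∣? c) ∧ true) *ℤ μ d) ∎
      where open ≡-Reasoning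

    ∑-μ-divisors-cancel : ∑[ d ∈ L ] (δ (d ∣? c) *ℤ μ d) ≡ + 0
    ∑-μ-divisors-cancel = begin
      ∑[ d ∈ L ] (δ (d ∣? c) *ℤ μ d)
        ≡⟨ ∑-cong L (λ d → χ-*-split (does (d ∣? c)) (does (p ∣? d)) (μ d)) ⟩
      ∑[ d ∈ L ] (χ (divisor-with-p d) *ℤ μ d +ℤ χ (divisor-without-p d) *ℤ μ d)
        ≡⟨ ∑-distrib-+ L (λ d → χ (divisor-with-p d) *ℤ μ d) (λ d → χ (divisor-without-p d) *ℤ μ d) ⟩
      (∑[ d ∈ L ] (χ (divisor-with-p d) *ℤ μ d)) +ℤ S
        ≡⟨ cong (_+ℤ S) (∑-reindex (enumerates-upTo (suc N)) (enumerates-upTo (suc N)) with-p-≤ times-p-≤ divide-by-p μ) ⟩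
      (∑[ d ∈ L ] (χ (does (p * d ∣? c)) *ℤ μ (p * d))) +ℤ S
        ≡⟨ cong (_+ℤ S) (∑-cong L μ-pair-off) ⟩
      (∑[ d ∈ L ] (- (χ (divisor-without-p d) *ℤ μ d))) +ℤ S
        ≡⟨ cong (_+ℤ S) (∑-neg L (λ d → χ (divisor-without-p d) *ℤ μ d)) ⟩
      - S +ℤ S
        ≡⟨ ℤₚ.+-inverseˡ S ⟩
      + 0 ∎
      where
      open ≡-Reasoning
      S = ∑[ d ∈ L ] (χ (divisor-without-p d) *ℤ μ d)
      ∣c⇒<1+N : ∀ {d} → d ∣ c → d < suc N
      ∣c⇒<1+N d∣c = s≤s (ℕₚ.≤-trans (∣⇒≤ d∣c) c≤N)
      with-p-≤ : ∀ {d} → divisor-with-p d ≡ true → does (d <? suc N) ≡ true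
      with-p-≤ {d} h = dec-true (d <? suc N) (∣c⇒<1+N (dec-witness (d ∣? c) (proj₁ (∧-elim h))))
      times-p-≤ : ∀ {d} → does (p * d ∣? c) ≡ true → does (d <? suc N) ≡ true
      times-p-≤ {d} h = dec-true (d <? suc N) (∣c⇒<1+N (m*n∣⇒n∣ p d (dec-witness (p * d ∣? c) h)))

  ∑-μ-divisors : ∀ {c N} .{{_ : NonZero c}} → c ≤ N → ∑[ d ∈ upTo (suc N) ] (δ (d ∣? c) *ℤ μ d) ≡ χ (does (c ≟ 1))
  ∑-μ-divisors {suc zero} {N} 1≤N = begin
    ∑[ d ∈ upTo (suc N) ] (δ (d ∣? 1) *ℤ μ d)
      ≡⟨ ∑-cong (upTo (suc N)) (λ d → cong (_*ℤ μ d) (δ-⇔ (d ∣? 1) (1 ≟ d) (sym ∘ ∣1⇒≡1) (λ { refl → ∣-refl }))) ⟩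
    ∑[ d ∈ upTo (suc N) ] (δ (1 ≟ d) *ℤ μ d)
      ≡⟨ ∑-δ (enumerates-upTo (suc N)) 1 μ ⟩
    χ (does (1 <? suc N)) *ℤ + 1
      ≡⟨ cong (λ b → χ b *ℤ + 1) (dec-true (1 <? suc N) (s≤s 1≤N)) ⟩
    + 1 ∎
    where open ≡-Reasoning
  ∑-μ-divisors {c@(suc (suc _))} c≤N with p , p-prime , p∣c ← prime-factor {c} (s≤s (s≤s z≤n)) =
    ∑-μ-divisors-cancel c≤N p-prime p∣c

module DivisorSums where

  open Booleans
  open Sums
  open Enumerations
  open MöbiusFunction
  open import Data.Nat using (_*_; NonZero; ≢-nonZero⁻¹; >-nonZero⁻¹; nonTrivial⇒n>1)
  open import Data.Nat.Divisibility using (_∣?_; divides; ∣⇒≤)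
  open import Data.Integer using () renaming (_+_ to _+ℤ_; _*_ to _*ℤ_; _-_ to _-ℤ_)
  open import Algebra.Properties.CommutativeSemigroup ℤₚ.*-commutativeSemigroup using () renaming (x∙yz≈y∙xz to *ℤ-leftComm)
  open import Algebra.Properties.CommutativeSemigroup ℕₚ.*-commutativeSemigroup using () renaming (x∙yz≈y∙xz to *-leftComm)
  open import Algebra.Properties.Ring ℤₚ.+-*-ring using (x[y-z]≈xy-xz)
  open import Data.Nat.Primality using (Prime; prime⇒irreducible; prime⇒nonTrivial)

  ∑-factorisations : ℕ → (ℕ → ℕ → ℤ) → ℤ
  ∑-factorisations n H = ∑[ d ∈ upTo (suc n) ] ∑[ e ∈ upTo (suc n) ] (δ (d * e ≟ n) *ℤ H d e)

  factor-nonZero : ∀ d e {n} .{{_ : NonZero n}} → d * e ≡ n → NonZero e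
  factor-nonZero d zero    {n} de≡n = ⊥-elim (≢-nonZero⁻¹ n (trans (sym de≡n) (ℕₚ.*-zeroʳ d)))
  factor-nonZero d (suc e)     _    = _

  factors-≤ : ∀ d e {n} .{{_ : NonZero n}} → d * e ≡ n → d ≤ n × e ≤ n
  factors-≤ d e de≡n = ∣⇒≤ (divides e (trans (sym de≡n) (ℕₚ.*-comm d e))) , ∣⇒≤ (divides d (sym de≡n))

  ∑-cofactors : ∀ d {c N} .{{_ : NonZero c}} → c ≤ N → ∑[ b ∈ upTo (suc N) ] δ (d * b ≟ c) ≡ δ (d ∣? c)
  ∑-cofactors d {c} {N} c≤N with d ∣? c
  ... | no d∤c = ∑-zero (upTo (suc N)) (λ b → cong χ (dec-false (d * b ≟ c) (λ db≡c → d∤c (divides b (trans (sym db≡c) (ℕₚ.*-comm d b))))))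
  ... | yes (divides q c≡qd) = begin
    ∑[ b ∈ upTo (suc N) ] δ (d * b ≟ c)
      ≡⟨ ∑-cong (upTo (suc N)) (λ b → δ-⇔ (d * b ≟ c) (q ≟ b) cancel (λ { refl → sym (trans c≡qd (ℕₚ.*-comm q d)) })) ⟩
    ∑[ b ∈ upTo (suc N) ] δ (q ≟ b)
      ≡⟨ ∑-cong (upTo (suc N)) (λ b → sym (ℤₚ.*-identityʳ (δ (q ≟ b)))) ⟩
    ∑[ b ∈ upTo (suc N) ] (δ (q ≟ b) *ℤ + 1)
      ≡⟨ ∑-δ (enumerates-upTo (suc N)) q (λ _ → + 1) ⟩
    χ (does (q <? suc N)) *ℤ + 1
      ≡⟨ cong (λ b → χ b *ℤ + 1) (dec-true (q <? suc N) (s≤s (ℕₚ.≤-trans (proj₁ (factors-≤ q d (sym c≡qd))) c≤N))) ⟩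
    + 1 ∎
    where
    open ≡-Reasoning
    instance
      d≢0 : NonZero d
      d≢0 = factor-nonZero q d (sym c≡qd)
    cancel : ∀ {b} → d * b ≡ c → q ≡ b
    cancel {b} db≡c = ℕₚ.*-cancelˡ-≡ q b d (trans (ℕₚ.*-comm d q) (trans (sym c≡qd) (sym db≡c)))

  ∑-factorisations-μ : ∀ {c N} .{{_ : NonZero c}} → c ≤ N →
                       ∑[ d ∈ upTo (suc N) ] ∑[ b ∈ upTo (suc N) ] (δ (d * b ≟ c) *ℤ μ d) ≡ χ (does (c ≟ 1))
  ∑-factorisations-μ {c} {N} c≤N = begin
    ∑[ d ∈ U ] ∑[ b ∈ U ] (δ (d * b ≟ c) *ℤ μ d)    ≡⟨ ∑-cong U (λ d → ∑-*ʳ U (μ d) (λ b → δ (d * b ≟ c))) ⟩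
    ∑[ d ∈ U ] ((∑[ b ∈ U ] δ (d * b ≟ c)) *ℤ μ d)  ≡⟨ ∑-cong U (λ d → cong (_*ℤ μ d) (∑-cofactors d c≤N)) ⟩
    ∑[ d ∈ U ] (δ (d ∣? c) *ℤ μ d)                  ≡⟨ ∑-μ-divisors c≤N ⟩
    χ (does (c ≟ 1))                                ∎
    where
    open ≡-Reasoning
    U = upTo (suc N)

  ∑-pick : ∀ {n} .{{_ : NonZero n}} d m (X : ℤ) →
           ∑[ e ∈ upTo (suc n) ] (δ (m ≟ e) *ℤ (δ (d * e ≟ n) *ℤ X)) ≡ δ (d * m ≟ n) *ℤ X
  ∑-pick {n} d m X = begin
    ∑[ e ∈ upTo (suc n) ] (δ (m ≟ e) *ℤ (δ (d * e ≟ n) *ℤ X))  ≡⟨ ∑-δ (enumerates-upTo (suc n)) m (λ e → δ (d * e ≟ n) *ℤ X) ⟩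
    χ (does (m <? suc n)) *ℤ (δ (d * m ≟ n) *ℤ X)              ≡⟨ χ-*-absorb _ (does (d * m ≟ n)) X m≤n ⟩
    δ (d * m ≟ n) *ℤ X                                         ∎
    where
    open ≡-Reasoning
    m≤n : does (d * m ≟ n) ≡ true → does (m <? suc n) ≡ true
    m≤n h = dec-true (m <? suc n) (s≤s (proj₂ (factors-≤ d m (dec-witness (d * m ≟ n) h))))

  ∑-μ-multiples : ∀ {n} .{{_ : NonZero n}} a →
                  ∑[ d ∈ upTo (suc n) ] ∑[ b ∈ upTo (suc n) ] (δ (d * (a * b) ≟ n) *ℤ μ d) ≡ δ (n ≟ a)
  ∑-μ-multiples {n} a = begin
    ∑[ d ∈ U ] ∑[ b ∈ U ] (δ (d * (a * b) ≟ n) *ℤ μ d)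
      ≡⟨ ∑-cong U (λ d → ∑-cong U (λ b → insert-c d b)) ⟩
    ∑[ d ∈ U ] ∑[ b ∈ U ] ∑[ c ∈ U ] (δ (d * b ≟ c) *ℤ (δ (a * c ≟ n) *ℤ μ d))
      ≡⟨ ∑-cong U (λ d → ∑-comm U U (λ b c → δ (d * b ≟ c) *ℤ (δ (a * c ≟ n) *ℤ μ d))) ⟩
    ∑[ d ∈ U ] ∑[ c ∈ U ] ∑[ b ∈ U ] (δ (d * b ≟ c) *ℤ (δ (a * c ≟ n) *ℤ μ d))
      ≡⟨ ∑-comm U U (λ d c → ∑[ b ∈ U ] (δ (d * b ≟ c) *ℤ (δ (a * c ≟ n) *ℤ μ d))) ⟩
    ∑[ c ∈ U ] ∑[ d ∈ U ] ∑[ b ∈ U ] (δ (d * b ≟ c) *ℤ (δ (a * c ≟ n) *ℤ μ d))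
      ≡⟨ ∑-cong U (λ c → factor-out c) ⟩
    ∑[ c ∈ U ] (δ (a * c ≟ n) *ℤ (∑[ d ∈ U ] ∑[ b ∈ U ] (δ (d * b ≟ c) *ℤ μ d)))
      ≡⟨ ∑-cong U (λ c → χ-*-cong (does (a * c ≟ n)) (inner-μ c)) ⟩
    ∑[ c ∈ U ] (δ (a * c ≟ n) *ℤ χ (does (c ≟ 1)))
      ≡⟨ ∑-cong U (λ c → trans (ℤₚ.*-comm (δ (a * c ≟ n)) (δ (c ≟ 1))) (cong (_*ℤ δ (a * c ≟ n)) (δ-⇔ (c ≟ 1) (1 ≟ c) sym sym))) ⟩
    ∑[ c ∈ U ] (δ (1 ≟ c) *ℤ δ (a * c ≟ n))
      ≡⟨ ∑-δ (enumerates-upTo (suc n)) 1 (λ c → δ (a * c ≟ n)) ⟩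
    χ (does (1 <? suc n)) *ℤ δ (a * 1 ≟ n)
      ≡⟨ cong (λ b → χ b *ℤ δ (a * 1 ≟ n)) (dec-true (1 <? suc n) (s≤s (>-nonZero⁻¹ n))) ⟩
    + 1 *ℤ δ (a * 1 ≟ n)
      ≡⟨ ℤₚ.*-identityˡ _ ⟩
    δ (a * 1 ≟ n)
      ≡⟨ δ-⇔ (a * 1 ≟ n) (n ≟ a) (λ eq → trans (sym eq) (ℕₚ.*-identityʳ a)) (λ { refl → ℕₚ.*-identityʳ n }) ⟩
    δ (n ≟ a) ∎
    where
    open ≡-Reasoning
    U = upTo (suc n)
    insert-c : ∀ d b → δ (d * (a * b) ≟ n) *ℤ μ d ≡ ∑[ c ∈ U ] (δ (d * b ≟ c) *ℤ (δ (a * c ≟ n) *ℤ μ d))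
    insert-c d b = begin
      δ (d * (a * b) ≟ n) *ℤ μ d                            ≡⟨ cong (λ m → δ (m ≟ n) *ℤ μ d) (*-leftComm d a b) ⟩
      δ (a * (d * b) ≟ n) *ℤ μ d                            ≡⟨ sym (∑-pick a (d * b) (μ d)) ⟩
      ∑[ c ∈ U ] (δ (d * b ≟ c) *ℤ (δ (a * c ≟ n) *ℤ μ d))  ∎
    factor-out : ∀ c → ∑[ d ∈ U ] ∑[ b ∈ U ] (δ (d * b ≟ c) *ℤ (δ (a * c ≟ n) *ℤ μ d))
                       ≡ δ (a * c ≟ n) *ℤ (∑[ d ∈ U ] ∑[ b ∈ U ] (δ (d * b ≟ c) *ℤ μ d))
    factor-out c = trans (∑-cong U (λ d → ∑-cong U (λ b → *ℤ-leftComm (δ (d * b ≟ c)) (δ (a * c ≟ n)) (μ d))))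
                         (∑∑-*ˡ U U (δ (a * c ≟ n)) (λ d b → δ (d * b ≟ c) *ℤ μ d))
    inner-μ : ∀ c → does (a * c ≟ n) ≡ true → ∑[ d ∈ U ] ∑[ b ∈ U ] (δ (d * b ≟ c) *ℤ μ d) ≡ χ (does (c ≟ 1))
    inner-μ c h = ∑-factorisations-μ {{factor-nonZero a c ac≡n}} (proj₂ (factors-≤ a c ac≡n))
      where ac≡n = dec-witness (a * c ≟ n) h

  ∑-factorisations-widen : ∀ {e n} .{{_ : NonZero e}} → e ≤ n → (H : ℕ → ℕ → ℤ) →
                           ∑[ a ∈ upTo (suc n) ] ∑[ b ∈ upTo (suc n) ] (δ (a * b ≟ e) *ℤ H a b) ≡ ∑-factorisations e H
  ∑-factorisations-widen {e} {n} e≤n H =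
    trans (∑-upTo-extend (suc e) (suc n) (s≤s e≤n)
             (λ a e<a _ → ∑-zero (upTo (suc n)) (λ b → vanish a b (λ ab≡e → ℕₚ.<⇒≱ e<a (proj₁ (factors-≤ a b ab≡e))))))
          (∑-upTo-cong (suc e) (λ a _ → ∑-upTo-extend (suc e) (suc n) (s≤s e≤n)
             (λ b e<b _ → vanish a b (λ ab≡e → ℕₚ.<⇒≱ e<b (proj₂ (factors-≤ a b ab≡e))))))
    where
    vanish : ∀ a b → a * b ≢ e → δ (a * b ≟ e) *ℤ H a b ≡ + 0
    vanish a b ab≢e = χ-*-zero (does (a * b ≟ e)) (λ h → ⊥-elim (ab≢e (dec-witness (a * b ≟ e) h)))

  μ-inverts-divisor-sums : ∀ {n} .{{_ : NonZero n}} (G : ℕ → ℤ) →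
    ∑[ d ∈ upTo (suc n) ] ∑[ e ∈ upTo (suc n) ]
      (δ (d * e ≟ n) *ℤ (μ d *ℤ (∑[ a ∈ upTo (suc n) ] ∑[ b ∈ upTo (suc n) ] (δ (a * b ≟ e) *ℤ G a))))
    ≡ G n
  μ-inverts-divisor-sums {n} G = begin
    ∑[ d ∈ U ] ∑[ e ∈ U ] (δ (d * e ≟ n) *ℤ (μ d *ℤ (∑[ a ∈ U ] ∑[ b ∈ U ] (δ (a * b ≟ e) *ℤ G a))))
      ≡⟨ ∑-cong U (λ d → ∑-cong U (λ e → expand d e)) ⟩
    ∑[ d ∈ U ] ∑[ e ∈ U ] ∑[ a ∈ U ] ∑[ b ∈ U ] T d e a b
      ≡⟨ ∑⁴-reorder U T ⟩
    ∑[ a ∈ U ] ∑[ d ∈ U ] ∑[ b ∈ U ] ∑[ e ∈ U ] T d e a b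
      ≡⟨ ∑-cong U (λ a → ∑-cong U (λ d → ∑-cong U (λ b → ∑-pick d (a * b) (μ d *ℤ G a)))) ⟩
    ∑[ a ∈ U ] ∑[ d ∈ U ] ∑[ b ∈ U ] (δ (d * (a * b) ≟ n) *ℤ (μ d *ℤ G a))
      ≡⟨ ∑-cong U (λ a → pull-out a) ⟩
    ∑[ a ∈ U ] ((∑[ d ∈ U ] ∑[ b ∈ U ] (δ (d * (a * b) ≟ n) *ℤ μ d)) *ℤ G a)
      ≡⟨ ∑-cong U (λ a → cong (_*ℤ G a) (∑-μ-multiples a)) ⟩
    ∑[ a ∈ U ] (δ (n ≟ a) *ℤ G a)
      ≡⟨ ∑-δ (enumerates-upTo (suc n)) n G ⟩
    χ (does (n <? suc n)) *ℤ G n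
      ≡⟨ cong (λ b → χ b *ℤ G n) (dec-true (n <? suc n) ℕₚ.≤-refl) ⟩
    + 1 *ℤ G n
      ≡⟨ ℤₚ.*-identityˡ (G n) ⟩
    G n ∎
    where
    open ≡-Reasoning
    U = upTo (suc n)
    T : ℕ → ℕ → ℕ → ℕ → ℤ
    T d e a b = δ (a * b ≟ e) *ℤ (δ (d * e ≟ n) *ℤ (μ d *ℤ G a))
    expand : ∀ d e → δ (d * e ≟ n) *ℤ (μ d *ℤ (∑[ a ∈ U ] ∑[ b ∈ U ] (δ (a * b ≟ e) *ℤ G a))) ≡ ∑[ a ∈ U ] ∑[ b ∈ U ] T d e a b
    expand d e = begin
      δ (d * e ≟ n) *ℤ (μ d *ℤ (∑[ a ∈ U ] ∑[ b ∈ U ] (δ (a * b ≟ e) *ℤ G a)))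
        ≡⟨ cong (δ (d * e ≟ n) *ℤ_) (sym (∑∑-*ˡ U U (μ d) _)) ⟩
      δ (d * e ≟ n) *ℤ (∑[ a ∈ U ] ∑[ b ∈ U ] (μ d *ℤ (δ (a * b ≟ e) *ℤ G a)))
        ≡⟨ sym (∑∑-*ˡ U U (δ (d * e ≟ n)) _) ⟩
      ∑[ a ∈ U ] ∑[ b ∈ U ] (δ (d * e ≟ n) *ℤ (μ d *ℤ (δ (a * b ≟ e) *ℤ G a)))
        ≡⟨ ∑-cong U (λ a → ∑-cong U (λ b → shuffle (δ (d * e ≟ n)) (μ d) (δ (a * b ≟ e)) (G a))) ⟩
      ∑[ a ∈ U ] ∑[ b ∈ U ] T d e a b ∎
      where
      shuffle : ∀ x y z w → x *ℤ (y *ℤ (z *ℤ w)) ≡ z *ℤ (x *ℤ (y *ℤ w))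
      shuffle x y z w = trans (cong (x *ℤ_) (*ℤ-leftComm y z w)) (*ℤ-leftComm x z (y *ℤ w))
    pull-out : ∀ a → ∑[ d ∈ U ] ∑[ b ∈ U ] (δ (d * (a * b) ≟ n) *ℤ (μ d *ℤ G a))
                     ≡ (∑[ d ∈ U ] ∑[ b ∈ U ] (δ (d * (a * b) ≟ n) *ℤ μ d)) *ℤ G a
    pull-out a = trans (∑-cong U (λ d → ∑-cong U (λ b → sym (ℤₚ.*-assoc (δ (d * (a * b) ≟ n)) (μ d) (G a)))))
                       (∑∑-*ʳ U U (G a) (λ d b → δ (d * (a * b) ≟ n) *ℤ μ d))

  möbius-inversion : ∀ (F G : ℕ → ℤ) → (∀ m .{{_ : NonZero m}} → ∑-factorisations m (λ d _ → G d) ≡ F m) →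
                     ∀ n .{{_ : NonZero n}} → ∑-factorisations n (λ d e → μ d *ℤ F e) ≡ G n
  möbius-inversion F G divisor-sum n =
    trans (∑-cong U (λ d → ∑-cong U (λ e → χ-*-cong (does (d * e ≟ n)) (cong (μ d *ℤ_) ∘ F-as-sum d e))))
          (μ-inverts-divisor-sums G)
    where
    U = upTo (suc n)
    F-as-sum : ∀ d e → does (d * e ≟ n) ≡ true → F e ≡ ∑[ a ∈ U ] ∑[ b ∈ U ] (δ (a * b ≟ e) *ℤ G a)
    F-as-sum d e h = sym (trans (∑-factorisations-widen {{e≢0}} (proj₂ (factors-≤ d e de≡n)) (λ a _ → G a)) (divisor-sum e {{e≢0}}))
      where
      de≡n = dec-witness (d * e ≟ n) h
      e≢0 = factor-nonZero d e de≡n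

  ∑-factorisations-cong : ∀ n {H H′ : ℕ → ℕ → ℤ} → (∀ d e → H d e ≡ H′ d e) → ∑-factorisations n H ≡ ∑-factorisations n H′
  ∑-factorisations-cong n H≡H′ = ∑-cong (upTo (suc n)) (λ d → ∑-cong (upTo (suc n)) (λ e → cong (δ (d * e ≟ n) *ℤ_) (H≡H′ d e)))

  ∑-factorisations-- : ∀ n (H H′ : ℕ → ℕ → ℤ) →
                       ∑-factorisations n (λ d e → H d e -ℤ H′ d e) ≡ ∑-factorisations n H -ℤ ∑-factorisations n H′
  ∑-factorisations-- n H H′ = begin
    ∑[ d ∈ U ] ∑[ e ∈ U ] (δ (d * e ≟ n) *ℤ (H d e -ℤ H′ d e))
      ≡⟨ ∑-cong U (λ d → ∑-cong U (λ e → x[y-z]≈xy-xz (δ (d * e ≟ n)) (H d e) (H′ d e))) ⟩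
    ∑[ d ∈ U ] ∑[ e ∈ U ] (δ (d * e ≟ n) *ℤ H d e -ℤ δ (d * e ≟ n) *ℤ H′ d e)
      ≡⟨ ∑-cong U (λ d → ∑-distrib-- U (λ e → δ (d * e ≟ n) *ℤ H d e) (λ e → δ (d * e ≟ n) *ℤ H′ d e)) ⟩
    ∑[ d ∈ U ] ((∑[ e ∈ U ] (δ (d * e ≟ n) *ℤ H d e)) -ℤ (∑[ e ∈ U ] (δ (d * e ≟ n) *ℤ H′ d e)))
      ≡⟨ ∑-distrib-- U (λ d → ∑[ e ∈ U ] (δ (d * e ≟ n) *ℤ H d e)) (λ d → ∑[ e ∈ U ] (δ (d * e ≟ n) *ℤ H′ d e)) ⟩
    ∑-factorisations n H -ℤ ∑-factorisations n H′ ∎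
    where
    open ≡-Reasoning
    U = upTo (suc n)

  isProperFactorisation : ℕ → ℕ → ℕ → Bool
  isProperFactorisation n d e = (1 ≤ᵇ d) ∧ (d <ᵇ n) ∧ (d * e ≡ᵇ n)

  sumProperDivisors-∑ : ∀ n (f : ℕ → ℕ → ℤ) →
    sumProperDivisors n f ≡ ∑[ d ∈ upTo (suc n) ] ∑[ e ∈ upTo (suc n) ] (χ (isProperFactorisation n d e) *ℤ f d e)
  sumProperDivisors-∑ n f = begin
    Data.List.foldr _+ℤ_ (+ 0) (concatMap terms U)
      ≡⟨ foldr-∑ (concatMap terms U) ⟩
    ∑ (concatMap terms U) (λ t → t)
      ≡⟨ ∑-concatMap terms U (λ t → t) ⟩
    ∑[ d ∈ U ] ∑ (concatMap (term d) U) (λ t → t)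
      ≡⟨ ∑-cong U (λ d → ∑-concatMap (term d) U (λ t → t)) ⟩
    ∑[ d ∈ U ] ∑[ e ∈ U ] ∑ (term d e) (λ t → t)
      ≡⟨ ∑-cong U (λ d → ∑-cong U (λ e → singleton (isProperFactorisation n d e) (f d e))) ⟩
    ∑[ d ∈ U ] ∑[ e ∈ U ] (χ (isProperFactorisation n d e) *ℤ f d e) ∎
    where
    open ≡-Reasoning
    U = upTo (suc n)
    term : ℕ → ℕ → List ℤ
    term d e = if isProperFactorisation n d e then f d e ∷ [] else []
    terms : ℕ → List ℤ
    terms d = concatMap (term d) U
    foldr-∑ : ∀ xs → Data.List.foldr _+ℤ_ (+ 0) xs ≡ ∑ xs (λ t → t)
    foldr-∑ []       = refl
    foldr-∑ (x ∷ xs) = cong (x +ℤ_) (foldr-∑ xs)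
    singleton : ∀ c v → ∑ (if c then v ∷ [] else []) (λ t → t) ≡ χ c *ℤ v
    singleton true  v = trans (ℤₚ.+-identityʳ v) (sym (ℤₚ.*-identityˡ v))
    singleton false v = sym (ℤₚ.*-zeroˡ v)

  sumProperDivisors≡∑-factorisations : ∀ n .{{_ : NonZero n}} (f : ℕ → ℕ → ℤ) → f n 1 ≡ + 0 → sumProperDivisors n f ≡ ∑-factorisations n f
  sumProperDivisors≡∑-factorisations n f fn1≡0 =
    trans (sumProperDivisors-∑ n f) (∑-cong (upTo (suc n)) (λ d → ∑-cong (upTo (suc n)) (λ e → drop-improper d e)))
    where
    drop-improper : ∀ d e → χ (isProperFactorisation n d e) *ℤ f d e ≡ δ (d * e ≟ n) *ℤ f d e
    drop-improper d e with d * e ≟ n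
    ... | no de≢n = trans (χ-*-zero (isProperFactorisation n d e) (contradiction ∘ proj₂ ∘ ∧-elim ∘ proj₂ ∘ ∧-elim {1 ≤ᵇ d}))
                          (sym (χ-*-zero (does (d * e ≟ n)) contradiction))
      where
      contradiction : ∀ {c} → (d * e ≡ᵇ n) ≡ true → c ≡ + 0
      contradiction h = ⊥-elim (de≢n (dec-witness (d * e ≟ n) h))
    ... | yes de≡n rewrite dec-true (d * e ≟ n) de≡n with ℕₚ.m≤n⇒m<n∨m≡n (proj₁ (factors-≤ d e de≡n))
    ...   | inj₁ d<n = cong (λ b → χ b *ℤ f d e) (∧-intro (dec-true (1 ≤? d) 1≤d) (∧-intro (dec-true (d <? n) d<n) refl))
      where
      1≤d : 1 ≤ d
      1≤d = >-nonZero⁻¹ d {{factor-nonZero e d (trans (ℕₚ.*-comm e d) de≡n)}}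
    ...   | inj₂ refl with refl ← ℕₚ.*-cancelˡ-≡ e 1 d (trans de≡n (sym (ℕₚ.*-identityʳ d))) =
      trans (χ-*-zero ((1 ≤ᵇ d) ∧ (d <ᵇ d) ∧ true) (λ _ → fn1≡0)) (sym (χ-*-zero true (λ _ → fn1≡0)))

  sumProperDivisors-μ : ∀ n → 2 ≤ n → (F : ℕ → ℤ) →
                        sumProperDivisors n (λ d e → μ d *ℤ (F e -ℤ F 1)) ≡ ∑-factorisations n (λ d e → μ d *ℤ F e)
  sumProperDivisors-μ n@(suc _) 2≤n F = begin
    sumProperDivisors n (λ d e → μ d *ℤ (F e -ℤ F 1))
      ≡⟨ sumProperDivisors≡∑-factorisations n _ μn·0 ⟩
    ∑-factorisations n (λ d e → μ d *ℤ (F e -ℤ F 1))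
      ≡⟨ ∑-factorisations-cong n (λ d e → x[y-z]≈xy-xz (μ d) (F e) (F 1)) ⟩
    ∑-factorisations n (λ d e → μ d *ℤ F e -ℤ μ d *ℤ F 1)
      ≡⟨ ∑-factorisations-- n _ _ ⟩
    ∑-factorisations n (λ d e → μ d *ℤ F e) -ℤ ∑-factorisations n (λ d _ → μ d *ℤ F 1)
      ≡⟨ cong (∑-factorisations n (λ d e → μ d *ℤ F e) -ℤ_) constant-part ⟩
    ∑-factorisations n (λ d e → μ d *ℤ F e) -ℤ + 0
      ≡⟨ ℤₚ.+-identityʳ _ ⟩
    ∑-factorisations n (λ d e → μ d *ℤ F e) ∎
    where
    open ≡-Reasoning
    U = upTo (suc n)
    μn·0 : μ n *ℤ (F 1 -ℤ F 1) ≡ + 0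
    μn·0 = trans (cong (μ n *ℤ_) (ℤₚ.+-inverseʳ (F 1))) (ℤₚ.*-zeroʳ (μ n))
    constant-part : ∑-factorisations n (λ d _ → μ d *ℤ F 1) ≡ + 0
    constant-part = begin
      ∑[ d ∈ U ] ∑[ e ∈ U ] (δ (d * e ≟ n) *ℤ (μ d *ℤ F 1))
        ≡⟨ ∑-cong U (λ d → ∑-cong U (λ e → sym (ℤₚ.*-assoc (δ (d * e ≟ n)) (μ d) (F 1)))) ⟩
      ∑[ d ∈ U ] ∑[ e ∈ U ] (δ (d * e ≟ n) *ℤ μ d *ℤ F 1)
        ≡⟨ ∑∑-*ʳ U U (F 1) (λ d e → δ (d * e ≟ n) *ℤ μ d) ⟩
      (∑[ d ∈ U ] ∑[ e ∈ U ] (δ (d * e ≟ n) *ℤ μ d)) *ℤ F 1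
        ≡⟨ cong (_*ℤ F 1) (∑-factorisations-μ {n} {n} ℕₚ.≤-refl) ⟩
      χ (does (n ≟ 1)) *ℤ F 1
        ≡⟨ cong (λ b → χ b *ℤ F 1) (dec-false (n ≟ 1) (λ { refl → ℕₚ.<-irrefl refl 2≤n })) ⟩
      + 0 ∎

  sumProperDivisors-prime : ∀ {p} → Prime p → (f : ℕ → ℕ → ℤ) → sumProperDivisors p f ≡ f 1 p
  sumProperDivisors-prime {p} p-prime f = begin
    sumProperDivisors p f
      ≡⟨ sumProperDivisors-∑ p f ⟩
    ∑[ d ∈ U ] ∑[ e ∈ U ] (χ (isProperFactorisation p d e) *ℤ f d e)
      ≡⟨ ∑-cong U (λ d → ∑-cong U (λ e → only-1·p d e)) ⟩
    ∑[ d ∈ U ] ∑[ e ∈ U ] (δ (1 ≟ d) *ℤ (δ (p ≟ e) *ℤ f d e))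
      ≡⟨ ∑-cong U (λ d → ∑-*ˡ U (δ (1 ≟ d)) (λ e → δ (p ≟ e) *ℤ f d e)) ⟩
    ∑[ d ∈ U ] (δ (1 ≟ d) *ℤ (∑[ e ∈ U ] (δ (p ≟ e) *ℤ f d e)))
      ≡⟨ ∑-δ (enumerates-upTo (suc p)) 1 (λ d → ∑[ e ∈ U ] (δ (p ≟ e) *ℤ f d e)) ⟩
    χ (does (1 <? suc p)) *ℤ (∑[ e ∈ U ] (δ (p ≟ e) *ℤ f 1 e))
      ≡⟨ cong₂ (λ b x → χ b *ℤ x) (dec-true (1 <? suc p) (ℕₚ.m<n⇒m<1+n 1<p)) (∑-δ (enumerates-upTo (suc p)) p (f 1)) ⟩
    + 1 *ℤ (χ (does (p <? suc p)) *ℤ f 1 p)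
      ≡⟨ cong (λ b → + 1 *ℤ (χ b *ℤ f 1 p)) (dec-true (p <? suc p) ℕₚ.≤-refl) ⟩
    + 1 *ℤ (+ 1 *ℤ f 1 p)
      ≡⟨ trans (ℤₚ.*-identityˡ _) (ℤₚ.*-identityˡ _) ⟩
    f 1 p ∎
    where
    open ≡-Reasoning
    U = upTo (suc p)
    1<p : 1 < p
    1<p = nonTrivial⇒n>1 p {{prime⇒nonTrivial p-prime}}
    proper⇒1·p : ∀ d e → isProperFactorisation p d e ≡ true → (does (1 ≟ d) ∧ does (p ≟ e)) ≡ true
    proper⇒1·p d e h with 1≤d , rest ← ∧-elim {1 ≤ᵇ d} h with d<p , de≡p ← ∧-elim {d <ᵇ p} rest
      with prime⇒irreducible p-prime (divides e (trans (sym (dec-witness (d * e ≟ p) de≡p)) (ℕₚ.*-comm d e)))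
    ... | inj₁ refl = ∧-intro refl (dec-true (p ≟ e) (trans (sym (dec-witness (1 * e ≟ p) de≡p)) (ℕₚ.*-identityˡ e)))
    ... | inj₂ refl = ⊥-elim (ℕₚ.<-irrefl refl (dec-witness (d <? d) d<p))
    1·p⇒proper : ∀ d e → (does (1 ≟ d) ∧ does (p ≟ e)) ≡ true → isProperFactorisation p d e ≡ true
    1·p⇒proper d e h with ∧-elim h
    ... | d≡1 , e≡p with refl ← dec-witness (1 ≟ d) d≡1 | refl ← dec-witness (p ≟ e) e≡p =
      ∧-intro refl (∧-intro (dec-true (1 <? p) 1<p) (dec-true (1 * p ≟ p) (ℕₚ.*-identityˡ p)))
    only-1·p : ∀ d e → χ (isProperFactorisation p d e) *ℤ f d e ≡ δ (1 ≟ d) *ℤ (δ (p ≟ e) *ℤ f d e)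
    only-1·p d e = begin
      χ (isProperFactorisation p d e) *ℤ f d e  ≡⟨ cong (λ b → χ b *ℤ f d e) (≡-by-≡true (proper⇒1·p d e) (1·p⇒proper d e)) ⟩
      χ (does (1 ≟ d) ∧ does (p ≟ e)) *ℤ f d e  ≡⟨ cong (_*ℤ f d e) (χ-∧ (does (1 ≟ d)) (does (p ≟ e))) ⟩
      δ (1 ≟ d) *ℤ δ (p ≟ e) *ℤ f d e           ≡⟨ ℤₚ.*-assoc (δ (1 ≟ d)) (δ (p ≟ e)) (f d e) ⟩
      δ (1 ≟ d) *ℤ (δ (p ≟ e) *ℤ f d e)         ∎

module Search where

  open Booleans
  open Sums
  open import Data.Nat using (_+_)
  open import Data.Integer using () renaming (_+_ to _+ℤ_)

  -- the least l < N with P l, and N if there is none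
  find : (ℕ → Bool) → ℕ → ℕ
  find P zero    = 0
  find P (suc N) = if P 0 then 0 else suc (find (P ∘ suc) N)

  find-found : ∀ P N l → l < N → P l ≡ true → find P N < N × P (find P N) ≡ true
  find-found P (suc N) l l<N Pl with P 0 in P0
  ... | true  = s≤s z≤n , P0
  ... | false with l
  ...   | zero   = ⊥-elim (false≢true (trans (sym P0) Pl))
  ...   | suc l′ = Data.Product.map s≤s (λ h → h) (find-found (P ∘ suc) N l′ (ℕₚ.≤-pred l<N) Pl)

  find-least : ∀ P N l → P l ≡ true → find P N ≤ l
  find-least P zero    l Pl = z≤n
  find-least P (suc N) l Pl with P 0 in P0
  ... | true  = z≤n
  ... | false with l
  ...   | zero   = ⊥-elim (false≢true (trans (sym P0) Pl))
  ...   | suc l′ = s≤s (find-least (P ∘ suc) N l′ Pl)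

  indicator : Bool → ℕ
  indicator b = if b then 1 else 0

  count : ℕ → (ℕ → Bool) → ℕ
  count zero    P = 0
  count (suc N) P = count N P + indicator (P N)

  count-cong : ∀ N (P Q : ℕ → Bool) → (∀ l → l < N → P l ≡ Q l) → count N P ≡ count N Q
  count-cong zero    P Q P≡Q = refl
  count-cong (suc N) P Q P≡Q = cong₂ _+_ (count-cong N P Q (λ l l<N → P≡Q l (ℕₚ.m<n⇒m<1+n l<N))) (cong indicator (P≡Q N ℕₚ.≤-refl))

  indicator-mono : ∀ a b → (a ≡ true → b ≡ true) → indicator a ≤ indicator b
  indicator-mono false b _   = z≤n
  indicator-mono true  b a⇒b rewrite a⇒b refl = ℕₚ.≤-refl

  count-mono : ∀ N (P Q : ℕ → Bool) → (∀ l → l < N → P l ≡ true → Q l ≡ true) → count N P ≤ count N Q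
  count-mono zero    P Q P⇒Q = z≤n
  count-mono (suc N) P Q P⇒Q =
    ℕₚ.+-mono-≤ (count-mono N P Q (λ l l<N → P⇒Q l (ℕₚ.m<n⇒m<1+n l<N))) (indicator-mono (P N) (Q N) (P⇒Q N ℕₚ.≤-refl))

  count-strict : ∀ N (P Q : ℕ → Bool) → (∀ l → l < N → P l ≡ true → Q l ≡ true) →
                 ∀ l₀ → l₀ < N → Q l₀ ≡ true → P l₀ ≡ false → count N P < count N Q
  count-strict (suc N) P Q P⇒Q l₀ l₀<1+N Ql₀ Pl₀ with ℕₚ.m≤n⇒m<n∨m≡n (ℕₚ.≤-pred l₀<1+N)
  ... | inj₁ l₀<N = ℕₚ.+-mono-<-≤ (count-strict N P Q (λ l l<N → P⇒Q l (ℕₚ.m<n⇒m<1+n l<N)) l₀ l₀<N Ql₀ Pl₀)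
                                  (indicator-mono (P N) (Q N) (P⇒Q N ℕₚ.≤-refl))
  ... | inj₂ refl rewrite Ql₀ | Pl₀ = ℕₚ.+-mono-≤-< (count-mono N P Q (λ l l<N → P⇒Q l (ℕₚ.m<n⇒m<1+n l<N))) (s≤s z≤n)

  count-all : ∀ N → count N (λ _ → true) ≡ N
  count-all zero    = refl
  count-all (suc N) = trans (cong (_+ 1) (count-all N)) (ℕₚ.+-comm N 1)

  count-none : ∀ N → count N (λ _ → false) ≡ 0
  count-none zero    = refl
  count-none (suc N) = trans (ℕₚ.+-identityʳ _) (count-none N)

  count-< : ∀ N P l₀ → l₀ < N → P l₀ ≡ false → count N P < N
  count-< N P l₀ l₀<N Pl₀ =
    ℕₚ.<-≤-trans (count-strict N P (λ _ → true) (λ _ _ _ → refl) l₀ l₀<N refl Pl₀) (ℕₚ.≤-reflexive (count-all N))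

  count-> : ∀ N P l₀ → l₀ < N → P l₀ ≡ true → 0 < count N P
  count-> N P l₀ l₀<N Pl₀ =
    ℕₚ.≤-<-trans (ℕₚ.≤-reflexive (sym (count-none N))) (count-strict N (λ _ → false) P (λ _ _ ()) l₀ l₀<N Pl₀ refl)

  count-∑ : ∀ N P → + count N P ≡ ∑[ l ∈ upTo N ] χ (P l)
  count-∑ zero    P = refl
  count-∑ (suc N) P = begin
    + (count N P + indicator (P N))       ≡⟨ ℤₚ.pos-+ (count N P) (indicator (P N)) ⟩
    + count N P +ℤ + indicator (P N)      ≡⟨ cong₂ _+ℤ_ (count-∑ N P) (indicator≡χ (P N)) ⟩
    (∑[ l ∈ upTo N ] χ (P l)) +ℤ χ (P N)  ≡⟨ sym (∑-upTo-suc N (χ ∘ P)) ⟩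
    ∑[ l ∈ upTo (suc N) ] χ (P l)         ∎
    where
    open ≡-Reasoning
    indicator≡χ : ∀ b → + indicator b ≡ χ b
    indicator≡χ true  = refl
    indicator≡χ false = refl

module PeriodicWords where

  open Booleans
  open Sums
  open Enumerations
  open Search
  open DivisorSums using (∑-factorisations; ∑-cofactors)
  open import Data.Nat using (_+_; _*_; _^_; NonZero; >-nonZero)
  open import Data.Nat.DivMod using (_%_; _/_; m%n<n; m≡m%n+[m/n]*n; [m+n]%n≡m%n; m<n⇒m%n≡m)
  open import Data.Nat.Divisibility using (_∣_; _∣?_; divides; m%n≡0⇒n∣m; 0∣⇒≡0)
  open import Data.Integer using () renaming (_*_ to _*ℤ_)

  Periodic : (ℕ → A) → ℕ → Set
  Periodic F d = ∀ j → F (d + j) ≡ F j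

  periodic-cong : ∀ {F G : ℕ → A} → (∀ j → F j ≡ G j) → ∀ {d} → Periodic F d → Periodic G d
  periodic-cong F≡G {d} per j = trans (sym (F≡G (d + j))) (trans (per j) (F≡G j))

  periodic-multiple : ∀ {F : ℕ → A} {d} → Periodic F d → ∀ q x → F (q * d + x) ≡ F x
  periodic-multiple         per zero    x = refl
  periodic-multiple {F = F} {d} per (suc q) x =
    trans (cong F (ℕₚ.+-assoc d (q * d) x)) (trans (per (q * d + x)) (periodic-multiple per q x))

  periodic-% : ∀ {F : ℕ → A} {d} .{{_ : NonZero d}} → Periodic F d → ∀ j → F (j % d) ≡ F j
  periodic-% {F = F} {d} per j = trans (sym (periodic-multiple per (j / d) (j % d)))
                                       (cong F (trans (ℕₚ.+-comm (j / d * d) (j % d)) (sym (m≡m%n+[m/n]*n j d))))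

  periodic-window : ∀ {F : ℕ → A} {n} .{{_ : NonZero n}} → Periodic F n →
                    ∀ d → (∀ j → j < n → F (d + j) ≡ F j) → Periodic F d
  periodic-window {F = F} {n} per d window j = begin
    F (d + j)                    ≡⟨ cong (λ t → F (d + t)) (m≡m%n+[m/n]*n j n) ⟩
    F (d + (j % n + j / n * n))  ≡⟨ cong F (rearrange d (j % n) (j / n * n)) ⟩
    F (j / n * n + (d + j % n))  ≡⟨ periodic-multiple per (j / n) (d + j % n) ⟩
    F (d + j % n)                ≡⟨ window (j % n) (m%n<n j n) ⟩
    F (j % n)                    ≡⟨ periodic-% per j ⟩
    F j                          ∎
    where
    open ≡-Reasoning
    rearrange : ∀ a b c → a + (b + c) ≡ c + (a + b)
    rearrange a b c = trans (sym (ℕₚ.+-assoc a b c)) (ℕₚ.+-comm (a + b) c)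

  cycle : ∀ {m} → Vec A (suc m) → ℕ → A
  cycle {m = m} w j = lookup w (fromℕ< (m%n<n j (suc m)))

  cycle-% : ∀ {m} (w : Vec A (suc m)) i j → i % suc m ≡ j % suc m → cycle w i ≡ cycle w j
  cycle-% {m = m} w i j i≡j = cong (lookup w) (Finₚ.fromℕ<-cong (i % suc m) (j % suc m) i≡j (m%n<n i (suc m)) (m%n<n j (suc m)))

  cycle-periodic : ∀ {m} (w : Vec A (suc m)) → Periodic (cycle w) (suc m)
  cycle-periodic {m = m} w j = cycle-% w (suc m + j) j (trans (cong (_% suc m) (ℕₚ.+-comm (suc m) j)) ([m+n]%n≡m%n j (suc m)))

  cycle-lookup : ∀ {m} (w : Vec A (suc m)) (i : Fin (suc m)) → cycle w (toℕ i) ≡ lookup w i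
  cycle-lookup {m = m} w i = cong (lookup w) (trans
    (Finₚ.fromℕ<-cong (toℕ i % suc m) (toℕ i) (m<n⇒m%n≡m (Finₚ.toℕ<n i)) (m%n<n (toℕ i) (suc m)) (Finₚ.toℕ<n i))
    (Finₚ.fromℕ<-toℕ i (Finₚ.toℕ<n i)))

  cycle-tabulate : ∀ {m} (F : ℕ → A) → Periodic F (suc m) → ∀ j → cycle (tabulate {n = suc m} (F ∘ toℕ)) j ≡ F j
  cycle-tabulate {m = m} F per j = begin
    cycle (tabulate (F ∘ toℕ)) j        ≡⟨ Vecₚ.lookup∘tabulate (F ∘ toℕ) _ ⟩
    F (toℕ (fromℕ< (m%n<n j (suc m))))  ≡⟨ cong F (Finₚ.toℕ-fromℕ< (m%n<n j (suc m))) ⟩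
    F (j % suc m)                       ≡⟨ periodic-% per j ⟩
    F j                                 ∎
    where open ≡-Reasoning

  cycle-injective : ∀ {m} (v w : Vec A (suc m)) → (∀ j → cycle v j ≡ cycle w j) → v ≡ w
  cycle-injective v w v≡w = trans (sym (Vecₚ.tabulate∘lookup v))
    (trans (Vecₚ.tabulate-cong (λ i → trans (sym (cycle-lookup v i)) (trans (v≡w (toℕ i)) (cycle-lookup w i))))
           (Vecₚ.tabulate∘lookup w))

  hasPeriod : ∀ {m} → Vec Bool (suc m) → ℕ → Bool
  hasPeriod {m} w d = all (λ j → does (cycle w (d + j) Boolₚ.≟ cycle w j)) (upTo (suc m))

  hasPeriod⇒periodic : ∀ {m} (w : Vec Bool (suc m)) d → hasPeriod w d ≡ true → Periodic (cycle w) d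
  hasPeriod⇒periodic {m} w d h = periodic-window (cycle-periodic w) d
    (λ j j<n → dec-witness (cycle w (d + j) Boolₚ.≟ cycle w j) (all-upTo⁻ _ (suc m) h j j<n))

  periodic⇒hasPeriod : ∀ {m} (w : Vec Bool (suc m)) d → Periodic (cycle w) d → hasPeriod w d ≡ true
  periodic⇒hasPeriod {m} w d per = all-upTo⁺ _ (suc m) (λ j _ → dec-true (cycle w (d + j) Boolₚ.≟ cycle w j) (per j))

  isPeriod : ∀ {m} → Vec Bool (suc m) → ℕ → Bool
  isPeriod w d = (1 ≤ᵇ d) ∧ hasPeriod w d

  isMinimalPeriod : ∀ {m} → Vec Bool (suc m) → ℕ → Bool
  isMinimalPeriod w d = isPeriod w d ∧ all (not ∘ isPeriod w) (upTo d)

  isPeriod-length : ∀ {m} (w : Vec Bool (suc m)) → isPeriod w (suc m) ≡ true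
  isPeriod-length {m} w = periodic⇒hasPeriod w (suc m) (cycle-periodic w)

  isPeriod-cycle : ∀ {m k} (v : Vec Bool (suc m)) (w : Vec Bool (suc k)) → (∀ j → cycle v j ≡ cycle w j) →
                   ∀ d → isPeriod v d ≡ isPeriod w d
  isPeriod-cycle v w v≡w d = cong ((1 ≤ᵇ d) ∧_) (≡-by-≡true
    (λ h → periodic⇒hasPeriod w d (periodic-cong v≡w {d} (hasPeriod⇒periodic v d h)))
    (λ h → periodic⇒hasPeriod v d (periodic-cong (sym ∘ v≡w) {d} (hasPeriod⇒periodic w d h))))

  isMinimalPeriod-cycle : ∀ {m k} (v : Vec Bool (suc m)) (w : Vec Bool (suc k)) → (∀ j → cycle v j ≡ cycle w j) →
                          ∀ d → isMinimalPeriod v d ≡ isMinimalPeriod w d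
  isMinimalPeriod-cycle v w v≡w d =
    cong₂ _∧_ (isPeriod-cycle v w v≡w d) (all-cong (upTo d) (λ d′ → cong not (isPeriod-cycle v w v≡w d′)))
    where
    all-cong : ∀ xs {f g : ℕ → Bool} → (∀ x → f x ≡ g x) → all f xs ≡ all g xs
    all-cong []       f≡g = refl
    all-cong (x ∷ xs) f≡g = cong₂ _∧_ (f≡g x) (all-cong xs f≡g)

  isPrimitive : ∀ {m} → Vec Bool (suc m) → Bool
  isPrimitive {m} u = isMinimalPeriod u (suc m)

  minimalPeriod : ∀ {m} → Vec Bool (suc m) → ℕ
  minimalPeriod {m} w = find (isPeriod w) (suc (suc m))

  minimalPeriod-≤ : ∀ {m} (w : Vec Bool (suc m)) → minimalPeriod w < suc (suc m)
  minimalPeriod-≤ {m} w = proj₁ (find-found (isPeriod w) (suc (suc m)) (suc m) ℕₚ.≤-refl (isPeriod-length w))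

  isMinimalPeriod≡ : ∀ {m} (w : Vec Bool (suc m)) d → isMinimalPeriod w d ≡ does (minimalPeriod w ≟ d)
  isMinimalPeriod≡ {m} w d = ≡-by-≡true minimal⇒≡ ≡⇒minimal
    where
    period : isPeriod w (minimalPeriod w) ≡ true
    period = proj₂ (find-found (isPeriod w) (suc (suc m)) (suc m) ℕₚ.≤-refl (isPeriod-length w))
    below-not-period : ∀ d′ → d′ < minimalPeriod w → not (isPeriod w d′) ≡ true
    below-not-period d′ d′<min with isPeriod w d′ in per
    ... | true  = ⊥-elim (ℕₚ.<⇒≱ d′<min (find-least (isPeriod w) (suc (suc m)) d′ per))
    ... | false = refl
    minimal⇒≡ : isMinimalPeriod w d ≡ true → does (minimalPeriod w ≟ d) ≡ true
    minimal⇒≡ h with per , below ← ∧-elim {isPeriod w d} h with ℕₚ.<-cmp (minimalPeriod w) d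
    ... | tri< min<d _ _ = ⊥-elim (false≢true (trans (cong not (sym period)) (all-upTo⁻ (not ∘ isPeriod w) d below _ min<d)))
    ... | tri≈ _ min≡d _ = dec-true (minimalPeriod w ≟ d) min≡d
    ... | tri> _ _ d<min = ⊥-elim (false≢true (trans (sym (cong not per)) (below-not-period d d<min)))
    ≡⇒minimal : does (minimalPeriod w ≟ d) ≡ true → isMinimalPeriod w d ≡ true
    ≡⇒minimal h with refl ← dec-witness (minimalPeriod w ≟ d) h =
      ∧-intro period (all-upTo⁺ (not ∘ isPeriod w) (minimalPeriod w) below-not-period)

  ∑-isMinimalPeriod : ∀ {m} (w : Vec Bool (suc m)) → ∑[ d ∈ upTo (suc (suc m)) ] χ (isMinimalPeriod w d) ≡ + 1
  ∑-isMinimalPeriod {m} w = begin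
    ∑[ d ∈ U ] χ (isMinimalPeriod w d)                ≡⟨ ∑-cong U (λ d → cong χ (isMinimalPeriod≡ w d)) ⟩
    ∑[ d ∈ U ] δ (minimalPeriod w ≟ d)                ≡⟨ ∑-cong U (λ d → sym (ℤₚ.*-identityʳ (δ (minimalPeriod w ≟ d)))) ⟩
    ∑[ d ∈ U ] (δ (minimalPeriod w ≟ d) *ℤ + 1)       ≡⟨ ∑-δ (enumerates-upTo (suc (suc m))) (minimalPeriod w) (λ _ → + 1) ⟩
    χ (does (minimalPeriod w <? suc (suc m))) *ℤ + 1  ≡⟨ cong (λ b → χ b *ℤ + 1) (dec-true (minimalPeriod w <? suc (suc m)) (minimalPeriod-≤ w)) ⟩
    + 1                                               ∎
    where
    open ≡-Reasoning
    U = upTo (suc (suc m))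

  minimalPeriod-∣ : ∀ {m} (w : Vec Bool (suc m)) d → isMinimalPeriod w d ≡ true → d ∣ suc m
  minimalPeriod-∣ {m} w d h with per , below ← ∧-elim {isPeriod w d} h with 1≤d , has-d ← ∧-elim {1 ≤ᵇ d} per =
    remainder-zero (n % d) refl
    where
    n = suc m
    instance
      d≢0 : NonZero d
      d≢0 = >-nonZero (dec-witness (1 ≤? d) 1≤d)
    periodic-d : Periodic (cycle w) d
    periodic-d = hasPeriod⇒periodic w d has-d
    periodic-rem : Periodic (cycle w) (n % d)
    periodic-rem j = begin
      cycle w (n % d + j)                      ≡⟨ sym (periodic-multiple periodic-d (n / d) (n % d + j)) ⟩
      cycle w (n / d * d + (n % d + j))        ≡⟨ cong (cycle w) (trans (sym (ℕₚ.+-assoc (n / d * d) (n % d) j))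
                                                                        (cong (_+ j) (trans (ℕₚ.+-comm (n / d * d) (n % d)) (sym (m≡m%n+[m/n]*n n d))))) ⟩
      cycle w (n + j)  ≡⟨ cycle-periodic w j ⟩
      cycle w j        ∎
      where open ≡-Reasoning
    remainder-zero : ∀ r → n % d ≡ r → d ∣ n
    remainder-zero zero    r≡0 = m%n≡0⇒n∣m n d r≡0
    remainder-zero (suc r) r≡  = ⊥-elim (false≢true (trans (sym (cong not r-period))
      (all-upTo⁻ (not ∘ isPeriod w) d below (suc r) (subst (_< d) r≡ (m%n<n n d)))))
      where
      r-period : isPeriod w (suc r) ≡ true
      r-period = periodic⇒hasPeriod w (suc r) (subst (Periodic (cycle w)) r≡ periodic-rem)

  isPrimitive⇒aperiodic : ∀ {m} (u : Vec Bool (suc m)) → isPrimitive u ≡ true → ∀ d → 1 ≤ d → d < suc m → ¬ Periodic (cycle u) d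
  isPrimitive⇒aperiodic {m} u prim d 1≤d d<n periodic = false≢true (trans (sym (cong not is-period)) not-period)
    where
    is-period : isPeriod u d ≡ true
    is-period = ∧-intro (dec-true (1 ≤? d) 1≤d) (periodic⇒hasPeriod u d periodic)
    not-period : not (isPeriod u d) ≡ true
    not-period = all-upTo⁻ (not ∘ isPeriod u) (suc m) (proj₂ (∧-elim {isPeriod u (suc m)} prim)) d d<n

  binaryWords : (k : ℕ) → List (Vec Bool k)
  binaryWords = vectors (true ∷ false ∷ [])

  enumerates-binaryWords : ∀ k → Complete (Vecₚ.≡-dec Boolₚ._≟_) (binaryWords k)
  enumerates-binaryWords = enumerates-vectors (enumerates λ { true → refl ; false → refl })

  ∑-vectors-1 : ∀ (xs : List A) k → ∑[ _ ∈ vectors xs k ] + 1 ≡ + (length xs ^ k)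
  ∑-vectors-1 xs zero    = refl
  ∑-vectors-1 xs (suc k) = begin
    ∑[ _ ∈ vectors xs (suc k) ] + 1
      ≡⟨ ∑-concatMap _ xs (λ _ → + 1) ⟩
    ∑[ x ∈ xs ] ∑[ _ ∈ map (x ∷_) (vectors xs k) ] + 1
      ≡⟨ ∑-cong xs (λ x → trans (∑-map (x ∷_) (vectors xs k) (λ _ → + 1)) (∑-vectors-1 xs k)) ⟩
    ∑[ _ ∈ xs ] + (length xs ^ k)
      ≡⟨ ∑-const xs (+ (length xs ^ k)) ⟩
    + length xs *ℤ + (length xs ^ k)
      ≡⟨ sym (ℤₚ.pos-* (length xs) (length xs ^ k)) ⟩
    + (length xs ^ suc k) ∎
    where open ≡-Reasoning

  primitiveCount : ℕ → ℤ
  primitiveCount zero    = + 0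
  primitiveCount (suc k) = ∑[ u ∈ binaryWords (suc k) ] χ (isPrimitive u)

  resize : ∀ {m} k → Vec A (suc m) → Vec A (suc k)
  resize k w = tabulate (cycle w ∘ toℕ)

  cycle-resize : ∀ {m} k (w : Vec A (suc m)) → Periodic (cycle w) (suc k) → ∀ j → cycle (resize k w) j ≡ cycle w j
  cycle-resize k w = cycle-tabulate (cycle w)

  ∑-isMinimalPeriod-divisor : ∀ k d′ → suc d′ ∣ suc k →
                              ∑[ w ∈ binaryWords (suc k) ] χ (isMinimalPeriod w (suc d′)) ≡ primitiveCount (suc d′)
  ∑-isMinimalPeriod-divisor k d′ (divides q 1+k≡q·d) =
    ∑-reindex-χ (enumerates-binaryWords (suc k)) (enumerates-binaryWords (suc d′)) (λ _ → refl) (λ _ → refl) truncation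
    where
    d = suc d′
    period-of : ∀ {m} (w : Vec Bool (suc m)) → isMinimalPeriod w d ≡ true → Periodic (cycle w) d
    period-of w h = hasPeriod⇒periodic w d (proj₂ (∧-elim {1 ≤ᵇ d} (proj₁ (∧-elim {isPeriod w d} h))))
    repeated : ∀ (u : Vec Bool d) → ∀ j → cycle (resize k u) j ≡ cycle u j
    repeated u = cycle-resize k u (λ j → trans (cong (λ t → cycle u (t + j)) 1+k≡q·d) (periodic-multiple (cycle-periodic u) q j))
    truncation : SubsetBijection (λ (w : Vec Bool (suc k)) → isMinimalPeriod w d) isPrimitive
    truncation = record
      { to      = resize d′
      ; from    = resize k
      ; to-∈    = λ {w} h → trans (isMinimalPeriod-cycle (resize d′ w) w (cycle-resize d′ w (period-of w h)) d) h
      ; from-∈  = λ {u} h → trans (isMinimalPeriod-cycle (resize k u) u (repeated u) d) h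
      ; from∘to = λ {w} h → cycle-injective _ w (λ j → trans (repeated (resize d′ w) j) (cycle-resize d′ w (period-of w h) j))
      ; to∘from = λ {u} _ → cycle-injective _ u (λ j → trans (cycle-resize d′ (resize k u) (periodic-cong (sym ∘ repeated u) {d} (cycle-periodic u)) j)
                                                              (repeated u j))
      }

  ∑-factorisations-primitiveCount : ∀ n .{{_ : NonZero n}} → ∑-factorisations n (λ d _ → primitiveCount d) ≡ + (2 ^ n)
  ∑-factorisations-primitiveCount n@(suc k) = begin
    ∑[ d ∈ U ] ∑[ e ∈ U ] (δ (d * e ≟ n) *ℤ primitiveCount d)
      ≡⟨ ∑-cong U (λ d → ∑-*ʳ U (primitiveCount d) (λ e → δ (d * e ≟ n))) ⟩
    ∑[ d ∈ U ] ((∑[ e ∈ U ] δ (d * e ≟ n)) *ℤ primitiveCount d)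
      ≡⟨ ∑-cong U (λ d → cong (_*ℤ primitiveCount d) (∑-cofactors d ℕₚ.≤-refl)) ⟩
    ∑[ d ∈ U ] (δ (d ∣? n) *ℤ primitiveCount d)
      ≡⟨ ∑-cong U (λ d → sym (by-minimal-period d)) ⟩
    ∑[ d ∈ U ] ∑[ w ∈ W ] χ (isMinimalPeriod w d)
      ≡⟨ ∑-comm U W (λ d w → χ (isMinimalPeriod w d)) ⟩
    ∑[ w ∈ W ] ∑[ d ∈ U ] χ (isMinimalPeriod w d)
      ≡⟨ ∑-cong W ∑-isMinimalPeriod ⟩
    ∑[ _ ∈ W ] + 1
      ≡⟨ ∑-vectors-1 (true ∷ false ∷ []) n ⟩
    + (2 ^ n) ∎
    where
    open ≡-Reasoning
    U = upTo (suc n)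
    W = binaryWords n
    by-minimal-period : ∀ d → ∑[ w ∈ W ] χ (isMinimalPeriod w d) ≡ δ (d ∣? n) *ℤ primitiveCount d
    by-minimal-period d with d ∣? n
    ... | no d∤n = ∑-zero W (λ w → cong χ (not-minimal w))
      where
      not-minimal : ∀ w → isMinimalPeriod w d ≡ false
      not-minimal w with isMinimalPeriod w d in min
      ... | true  = ⊥-elim (d∤n (minimalPeriod-∣ w d min))
      ... | false = refl
    ... | yes d∣n with d
    ...   | zero   with () ← 0∣⇒≡0 d∣n
    ...   | suc d′ = trans (∑-isMinimalPeriod-divisor k d′ d∣n) (sym (ℤₚ.*-identityˡ _))

module Permutations where

  open Booleans
  open import Data.Nat using (_+_; _*_; _∸_)
  open import Data.Nat.DivMod using (_%_; _/_; m%n<n; m≡m%n+[m/n]*n)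
  open import Data.List.Relation.Unary.All using (All; _∷_)
  open import Data.List.Relation.Unary.AllPairs using (_∷_)
  open import Data.List.Relation.Unary.Unique.Propositional using (Unique)
  import Data.List.Relation.Unary.Unique.Propositional.Properties as Uniqueₚ
  open import Data.List.Relation.Unary.Unique.DecPropositional using (unique?)
  open import Function.Definitions using (Injective)

  lookup-injective : ∀ {k} (v : Vec A k) → Unique (Data.Vec.toList v) → Injective _≡_ _≡_ (lookup v)
  lookup-injective (x ∷ v) (x∉v ∷ u) {fzero}  {fzero}  _  = refl
  lookup-injective (x ∷ v) (x∉v ∷ u) {fzero}  {fsuc j} eq = ⊥-elim (lookup-All v x∉v j eq)
    where
    lookup-All : ∀ {k} {P : A → Set} (v : Vec A k) → All P (Data.Vec.toList v) → ∀ j → P (lookup v j)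
    lookup-All (y ∷ v) (py ∷ _)  fzero    = py
    lookup-All (y ∷ v) (_  ∷ pv) (fsuc j) = lookup-All v pv j
  lookup-injective (x ∷ v) (x∉v ∷ u) {fsuc i} {fzero}  eq = sym (lookup-injective (x ∷ v) (x∉v ∷ u) (sym eq))
  lookup-injective (x ∷ v) (x∉v ∷ u) {fsuc i} {fsuc j} eq = cong fsuc (lookup-injective v u eq)

  isPerm⇒injective : ∀ {n} (π : Vec (Fin n) n) → isPerm π ≡ true → Injective _≡_ _≡_ (lookup π)
  isPerm⇒injective π h = lookup-injective π (dec-witness (unique? Finₚ._≟_ (Data.Vec.toList π)) h)

  injective⇒isPerm : ∀ {n} (h : Fin n → Fin n) → Injective _≡_ _≡_ h → isPerm (tabulate h) ≡ true
  injective⇒isPerm h h-injective = dec-true (unique? Finₚ._≟_ (Data.Vec.toList (tabulate h)))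
    (subst Unique (sym (toList-tabulate h)) (Uniqueₚ.tabulate⁺ h-injective))
    where
    toList-tabulate : ∀ {k} (f : Fin k → A) → Data.Vec.toList (tabulate f) ≡ Data.List.tabulate f
    toList-tabulate {k = zero}  f = refl
    toList-tabulate {k = suc k} f = cong (f fzero ∷_) (toList-tabulate (f ∘ fsuc))

  injective⇒surjective : ∀ {n} (h : Fin n → Fin n) → Injective _≡_ _≡_ h → ∀ y → Σ[ i ∈ Fin n ] h i ≡ y
  injective⇒surjective {suc n} h h-injective y with Finₚ.any? (λ i → h i Finₚ.≟ y)
  ... | yes hit = hit
  ... | no miss = ⊥-elim (ℕₚ.<-irrefl refl (Finₚ.injective⇒≤ squeezed-injective))
    where
    squeezed : Fin (suc n) → Fin n
    squeezed i = Data.Fin.punchOut {i = y} {j = h i} (λ y≡hi → miss (i , sym y≡hi))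
    squeezed-injective : Injective _≡_ _≡_ squeezed
    squeezed-injective {i} {j} eq =
      h-injective (Finₚ.punchOut-injective (λ y≡hi → miss (i , sym y≡hi)) (λ y≡hj → miss (j , sym y≡hj)) eq)

  module NCycle {m : ℕ} (π : Vec (Fin (suc m)) (suc m)) (π-injective : Injective _≡_ _≡_ (lookup π))
                (π-cycle : ∀ k → k < m → iter π (suc k) fzero ≢ fzero) where

    n : ℕ
    n = suc m

    iter-+ : ∀ a b x → iter π (a + b) x ≡ iter π a (iter π b x)
    iter-+ zero    b x = refl
    iter-+ (suc a) b x = cong (lookup π) (iter-+ a b x)

    iter-suc : ∀ j x → iter π (suc j) x ≡ iter π j (lookup π x)
    iter-suc j x = trans (cong (λ t → iter π t x) (ℕₚ.+-comm 1 j)) (iter-+ j 1 x)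

    iter-injective : ∀ k {x y} → iter π k x ≡ iter π k y → x ≡ y
    iter-injective zero    eq = eq
    iter-injective (suc k) eq = iter-injective k (π-injective eq)

    iter-∸ : ∀ {a b} x → a ≤ b → iter π (b ∸ a) (iter π a x) ≡ iter π b x
    iter-∸ {a} {b} x a≤b = trans (sym (iter-+ (b ∸ a) a x)) (cong (λ t → iter π t x) (ℕₚ.m∸n+n≡m a≤b))

    no-early-return : ∀ d → 1 ≤ d → d < n → iter π d fzero ≢ fzero
    no-early-return (suc k) _ (s≤s k<m) = π-cycle k k<m

    orbit-of-0 : ∀ y → Σ[ s ∈ ℕ ] s < n × iter π s fzero ≡ y
    orbit-of-0 y = let (i , eq) = injective⇒surjective iterate-0 iterate-0-injective y in toℕ i , Finₚ.toℕ<n i , eq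
      where
      iterate-0 : Fin n → Fin n
      iterate-0 i = iter π (toℕ i) fzero
      distinct : ∀ i j → i < j → j < n → iter π i fzero ≢ iter π j fzero
      distinct i j i<j j<n eq = no-early-return (j ∸ i) (ℕₚ.m<n⇒0<n∸m i<j) (ℕₚ.≤-<-trans (ℕₚ.m∸n≤m j i) j<n)
        (iter-injective i (trans (sym (iter-+ i (j ∸ i) fzero))
                          (trans (cong (λ t → iter π t fzero) (ℕₚ.m+[n∸m]≡n (ℕₚ.<⇒≤ i<j))) (sym eq))))
      iterate-0-injective : Injective _≡_ _≡_ iterate-0
      iterate-0-injective {i} {j} eq with ℕₚ.<-cmp (toℕ i) (toℕ j)
      ... | tri< i<j _ _ = ⊥-elim (distinct (toℕ i) (toℕ j) i<j (Finₚ.toℕ<n j) eq)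
      ... | tri≈ _ i≡j _ = Finₚ.toℕ-injective i≡j
      ... | tri> _ _ j<i = ⊥-elim (distinct (toℕ j) (toℕ i) j<i (Finₚ.toℕ<n i) (sym eq))

    iter-n-0 : iter π n fzero ≡ fzero
    iter-n-0 with orbit-of-0 (iter π n fzero)
    ... | zero  , _   , eq = sym eq
    ... | suc s , s<n , eq = ⊥-elim (no-early-return (n ∸ suc s) (ℕₚ.m<n⇒0<n∸m s<n) (s≤s (ℕₚ.m∸n≤m m s))
                               (iter-injective (suc s) (trans (sym (iter-+ (suc s) (n ∸ suc s) fzero))
                                                       (trans (cong (λ t → iter π t fzero) (ℕₚ.m+[n∸m]≡n (ℕₚ.<⇒≤ s<n))) (sym eq)))))

    iter-n : ∀ y → iter π n y ≡ y
    iter-n y with s , _ , refl ← orbit-of-0 y = begin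
      iter π n (iter π s fzero)  ≡⟨ sym (iter-+ n s fzero) ⟩
      iter π (n + s) fzero       ≡⟨ cong (λ t → iter π t fzero) (ℕₚ.+-comm n s) ⟩
      iter π (s + n) fzero       ≡⟨ iter-+ s n fzero ⟩
      iter π s (iter π n fzero)  ≡⟨ cong (iter π s) iter-n-0 ⟩
      iter π s fzero             ∎
      where open ≡-Reasoning

    iter-*n+ : ∀ q j y → iter π (q * n + j) y ≡ iter π j y
    iter-*n+ zero    j y = refl
    iter-*n+ (suc q) j y = trans (cong (λ t → iter π t y) (ℕₚ.+-assoc n (q * n) j))
                                 (trans (iter-+ n (q * n + j) y) (trans (iter-n _) (iter-*n+ q j y)))

    no-fixed-point : ∀ d → 1 ≤ d → d < n → ∀ y → iter π d y ≢ y
    no-fixed-point d 1≤d d<n y eq with s , _ , refl ← orbit-of-0 y =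
      no-early-return d 1≤d d<n (iter-injective s (trans (sym (iter-+ s d fzero))
                                                   (trans (cong (λ t → iter π t fzero) (ℕₚ.+-comm s d)) (trans (iter-+ d s fzero) eq))))

    orbit : ∀ x y → Σ[ r ∈ ℕ ] r < n × iter π r x ≡ y
    orbit x y with s , s<n , refl ← orbit-of-0 x | t , _ , refl ← orbit-of-0 y =
      r % n , m%n<n r n , (begin
      iter π (r % n) (iter π s fzero)
        ≡⟨ sym (iter-+ (r % n) s fzero) ⟩
      iter π (r % n + s) fzero
        ≡⟨ sym (iter-*n+ (r / n) (r % n + s) fzero) ⟩
      iter π (r / n * n + (r % n + s)) fzero
        ≡⟨ cong (λ k → iter π k fzero) (trans (sym (ℕₚ.+-assoc (r / n * n) (r % n) s))
                                                       (cong (_+ s) (trans (ℕₚ.+-comm (r / n * n) (r % n)) (sym (m≡m%n+[m/n]*n r n))))) ⟩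
      iter π (r + s) fzero
        ≡⟨ cong (λ k → iter π k fzero) (trans (ℕₚ.+-assoc t (n ∸ s) s) (cong (_+_ t) (ℕₚ.m∸n+n≡m (ℕₚ.<⇒≤ s<n)))) ⟩
      iter π (t + n) fzero
        ≡⟨ cong (λ k → iter π k fzero) (trans (ℕₚ.+-comm t n) (cong (_+ t) (sym (ℕₚ.*-identityˡ n)))) ⟩
      iter π (1 * n + t) fzero
        ≡⟨ iter-*n+ 1 t fzero ⟩
      iter π t fzero                             ∎)
      where
      open ≡-Reasoning
      r = t + (n ∸ s)

module Descents where

  open Booleans
  open import Data.Nat using (_+_; _∸_)

  -- the i-th entry as a number, and 0 past the end
  entry : ∀ {n k} → Vec (Fin n) k → ℕ → ℕ
  entry []      i       = 0
  entry (x ∷ v) zero    = toℕ x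
  entry (x ∷ v) (suc i) = entry v i

  entry-lookup : ∀ {n k} (v : Vec (Fin n) k) i (i<k : i < k) → entry v i ≡ toℕ (lookup v (fromℕ< i<k))
  entry-lookup (x ∷ v) zero    _         = refl
  entry-lookup (x ∷ v) (suc i) (s≤s i<k) = entry-lookup v i i<k

  -- The length of the longest non-decreasing prefix: the (1-based) position i of the
  -- first descent v(i) > v(i+1), or the length of v if there is none.
  firstDescent : ∀ {n k} → Vec (Fin n) k → ℕ
  firstDescent []           = 0
  firstDescent (x ∷ [])     = 1
  firstDescent (x ∷ y ∷ xs) = if toℕ y <ᵇ toℕ x then 1 else suc (firstDescent (y ∷ xs))

  ≮ᵇ⇒≥ : ∀ {a b} → (b <ᵇ a) ≡ false → a ≤ b
  ≮ᵇ⇒≥ {a} {b} b≮a = ℕₚ.≮⇒≥ (λ b<a → false≢true (trans (sym b≮a) (dec-true (b <? a) b<a)))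

  ascending-before-firstDescent : ∀ {n k} (v : Vec (Fin n) k) i → suc i < firstDescent v → entry v i ≤ entry v (suc i)
  ascending-before-firstDescent (x ∷ []) zero (s≤s ())
  ascending-before-firstDescent (x ∷ y ∷ xs) i i<fd with toℕ y <ᵇ toℕ x in y<x
  ascending-before-firstDescent (x ∷ y ∷ xs) i       (s≤s ())      | true
  ascending-before-firstDescent (x ∷ y ∷ xs) zero    _             | false = ≮ᵇ⇒≥ y<x
  ascending-before-firstDescent (x ∷ y ∷ xs) (suc i) (s≤s 1+i<fd)  | false = ascending-before-firstDescent (y ∷ xs) i 1+i<fd

  des≡0⇒ascending : ∀ {n k} (v : Vec (Fin n) k) → desW v ≡ 0 → ∀ i → suc i < k → entry v i ≤ entry v (suc i)
  des≡0⇒ascending (x ∷ []) _ i (s≤s ())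
  des≡0⇒ascending (x ∷ y ∷ xs) des≡0 i i<k with toℕ y <ᵇ toℕ x in y<x
  des≡0⇒ascending (x ∷ y ∷ xs) ()    i       i<k       | true
  des≡0⇒ascending (x ∷ y ∷ xs) des≡0 zero    _         | false = ≮ᵇ⇒≥ y<x
  des≡0⇒ascending (x ∷ y ∷ xs) des≡0 (suc i) (s≤s i<k) | false = des≡0⇒ascending (y ∷ xs) des≡0 i i<k

  ascending⇒des≡0 : ∀ {n k} (v : Vec (Fin n) k) → (∀ i → suc i < k → entry v i ≤ entry v (suc i)) → desW v ≡ 0
  ascending⇒des≡0 []           _   = refl
  ascending⇒des≡0 (x ∷ [])     _   = refl
  ascending⇒des≡0 (x ∷ y ∷ xs) asc =
    trans (cong (λ b → (if b then 1 else 0) + desW (y ∷ xs)) (dec-false (toℕ y <? toℕ x) (ℕₚ.≤⇒≯ (asc 0 (s≤s (s≤s z≤n))))))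
          (ascending⇒des≡0 (y ∷ xs) (λ i i<k → asc (suc i) (s≤s i<k)))

  ascending-after-firstDescent : ∀ {n k} (v : Vec (Fin n) k) → desW v ≤ 1 →
                                 ∀ i → firstDescent v ≤ i → suc i < k → entry v i ≤ entry v (suc i)
  ascending-after-firstDescent (x ∷ []) _ i _ (s≤s ())
  ascending-after-firstDescent (x ∷ y ∷ xs) des≤1 i fd≤i i<k with toℕ y <ᵇ toℕ x
  ascending-after-firstDescent (x ∷ y ∷ xs) (s≤s des≤0) (suc i) _           (s≤s i<k) | true  =
    des≡0⇒ascending (y ∷ xs) (ℕₚ.n≤0⇒n≡0 des≤0) i i<k
  ascending-after-firstDescent (x ∷ y ∷ xs) des≤1       (suc i) (s≤s fd≤i) (s≤s i<k) | false =
    ascending-after-firstDescent (y ∷ xs) des≤1 i fd≤i i<k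

  firstDescent-≡ : ∀ {n k} (v : Vec (Fin n) k) z → 1 ≤ z → z < k → (∀ i → suc i < z → entry v i ≤ entry v (suc i)) →
                   entry v z < entry v (z ∸ 1) → firstDescent v ≡ z
  firstDescent-≡ (x ∷ []) (suc z) _ (s≤s ()) _ _
  firstDescent-≡ (x ∷ y ∷ xs) z 1≤z z<k asc descent with toℕ y <ᵇ toℕ x in y<x
  firstDescent-≡ (x ∷ y ∷ xs) 1             _ _         asc descent | true  = refl
  firstDescent-≡ (x ∷ y ∷ xs) (suc (suc z)) _ _         asc descent | true  =
    ⊥-elim (ℕₚ.<⇒≱ (dec-witness (toℕ y <? toℕ x) y<x) (asc 0 (s≤s (s≤s z≤n))))
  firstDescent-≡ (x ∷ y ∷ xs) 1             _ _         asc descent | false =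
    ⊥-elim (false≢true (trans (sym y<x) (dec-true (toℕ y <? toℕ x) descent)))
  firstDescent-≡ (x ∷ y ∷ xs) (suc (suc z)) _ (s≤s z<k) asc descent | false =
    cong suc (firstDescent-≡ (y ∷ xs) (suc z) (s≤s z≤n) z<k (λ i i<z → asc (suc i) (s≤s i<z)) descent)

  strictly-increasing⇒id : ∀ n (a : ℕ → ℕ) → (∀ k → suc k < n → a k < a (suc k)) → (∀ k → k < n → a k < n) →
                           ∀ k → k < n → a k ≡ k
  strictly-increasing⇒id (suc m) a increasing bounded k k<n = ℕₚ.≤-antisym (ℕₚ.+-cancelʳ-≤ (m ∸ k) (a k) k upper) lower
    where
    gap : ∀ k t → k + t < suc m → a k + t ≤ a (k + t)
    gap k zero    _  = ℕₚ.≤-reflexive (trans (ℕₚ.+-identityʳ (a k)) (cong a (sym (ℕₚ.+-identityʳ k))))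
    gap k (suc t) lt = begin
      a k + suc t      ≡⟨ ℕₚ.+-suc (a k) t ⟩
      suc (a k + t)    ≤⟨ s≤s (gap k t (ℕₚ.<-trans (ℕₚ.+-monoʳ-< k (ℕₚ.n<1+n t)) lt)) ⟩
      suc (a (k + t))  ≤⟨ increasing (k + t) (subst (_< suc m) (ℕₚ.+-suc k t) lt) ⟩
      a (suc (k + t))  ≡⟨ cong a (sym (ℕₚ.+-suc k t)) ⟩
      a (k + suc t)    ∎
      where open ℕₚ.≤-Reasoning
    lower : k ≤ a k
    lower = ℕₚ.≤-trans (ℕₚ.m≤n+m k (a 0)) (gap 0 k k<n)
    k+[m∸k]≡m : k + (m ∸ k) ≡ m
    k+[m∸k]≡m = ℕₚ.m+[n∸m]≡n (ℕₚ.≤-pred k<n)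
    upper : a k + (m ∸ k) ≤ k + (m ∸ k)
    upper = ℕₚ.≤-trans (gap k (m ∸ k) (subst (_< suc m) (sym k+[m∸k]≡m) ℕₚ.≤-refl))
                       (ℕₚ.≤-trans (ℕₚ.≤-pred (subst (λ t → a t < suc m) (sym k+[m∸k]≡m) (bounded m ℕₚ.≤-refl)))
                                   (ℕₚ.≤-reflexive (sym k+[m∸k]≡m)))

  ascending-but-one⇒des≤1 : ∀ {n k} (v : Vec (Fin n) k) z →
                            (∀ i → suc i < k → suc i ≢ z → entry v i ≤ entry v (suc i)) → desW v ≤ 1
  ascending-but-one⇒des≤1 []           z _   = z≤n
  ascending-but-one⇒des≤1 (x ∷ [])     z _   = z≤n
  ascending-but-one⇒des≤1 (x ∷ y ∷ xs) z asc =
    step (toℕ y <ᵇ toℕ x) refl (ascending-but-one⇒des≤1 (y ∷ xs) (z ∸ 1) (λ i i<k i≢z → asc (suc i) (s≤s i<k) (i≢z ∘ cong (_∸ 1))))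
    where
    step : ∀ b → (toℕ y <ᵇ toℕ x) ≡ b → desW (y ∷ xs) ≤ 1 → (if b then 1 else 0) + desW (y ∷ xs) ≤ 1
    step false _   des≤1 = des≤1
    step true  y<x _     =
      s≤s (ℕₚ.≤-reflexive (ascending⇒des≡0 (y ∷ xs) (λ i i<k → asc (suc i) (s≤s i<k) (λ 2+i≡z → 2+i≢1 (trans 2+i≡z z≡1)))))
      where
      z≡1 : z ≡ 1
      z≡1 with z ≟ 1
      ... | yes z≡1 = z≡1
      ... | no  z≢1 = ⊥-elim (ℕₚ.<⇒≱ (dec-witness (toℕ y <? toℕ x) y<x) (asc 0 (s≤s (s≤s z≤n)) (z≢1 ∘ sym)))
      2+i≢1 : ∀ {i} → suc (suc i) ≢ 1
      2+i≢1 ()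

module Lexicographic where

  open Booleans
  open import Data.Bool using (_∨_)

  lex< : ℕ → (ℕ → Bool) → (ℕ → Bool) → Bool
  lex< zero    A B = false
  lex< (suc L) A B = (not (A 0) ∧ B 0) ∨ (does (A 0 Boolₚ.≟ B 0) ∧ lex< L (A ∘ suc) (B ∘ suc))

  lex<-cong : ∀ L {A A′ B B′ : ℕ → Bool} → (∀ j → A j ≡ A′ j) → (∀ j → B j ≡ B′ j) → lex< L A B ≡ lex< L A′ B′
  lex<-cong zero    A≡A′ B≡B′ = refl
  lex<-cong (suc L) {A} {A′} {B} {B′} A≡A′ B≡B′ rewrite A≡A′ 0 | B≡B′ 0 =
    cong (λ t → (not (A′ 0) ∧ B′ 0) ∨ (does (A′ 0 Boolₚ.≟ B′ 0) ∧ t)) (lex<-cong L (A≡A′ ∘ suc) (B≡B′ ∘ suc))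

  lex<-irrefl : ∀ L (A : ℕ → Bool) → lex< L A A ≡ false
  lex<-irrefl zero    A = refl
  lex<-irrefl (suc L) A with A 0
  ... | true  = lex<-irrefl L (A ∘ suc)
  ... | false = lex<-irrefl L (A ∘ suc)

  lex<-trans : ∀ L (A B C : ℕ → Bool) → lex< L A B ≡ true → lex< L B C ≡ true → lex< L A C ≡ true
  lex<-trans (suc L) A B C A<B B<C with A 0 | B 0 | C 0
  ... | true  | true  | true  = lex<-trans L (A ∘ suc) (B ∘ suc) (C ∘ suc) A<B B<C
  ... | false | false | false = lex<-trans L (A ∘ suc) (B ∘ suc) (C ∘ suc) A<B B<C
  ... | false | false | true  = refl
  ... | false | true  | true  = refl
  ... | true  | false | _     = ⊥-elim (false≢true A<B)
  ... | _     | true  | false = ⊥-elim (false≢true B<C)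

  lex<-tail : ∀ L (A B : ℕ → Bool) → A 0 ≡ B 0 → lex< (suc L) A B ≡ lex< L (A ∘ suc) (B ∘ suc)
  lex<-tail L A B A0≡B0 with A 0 | B 0
  lex<-tail L A B refl | true  | .true  = refl
  lex<-tail L A B refl | false | .false = refl

  lex<-head : ∀ L (A B : ℕ → Bool) → A 0 ≡ false → B 0 ≡ true → lex< (suc L) A B ≡ true
  lex<-head L A B A0 B0 rewrite A0 | B0 = refl

  lex<-head-true : ∀ L (A B : ℕ → Bool) → lex< L A B ≡ true → A 0 ≡ true → B 0 ≡ true
  lex<-head-true (suc L) A B A<B A0 with A 0 | B 0
  ... | true  | true  = refl
  ... | true  | false = ⊥-elim (false≢true A<B)
  lex<-head-true (suc L) A B A<B () | false | _

  lex<-suc : ∀ L (A B : ℕ → Bool) → lex< L A B ≡ true → lex< (suc L) A B ≡ true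
  lex<-suc (suc L) A B A<B with A 0 | B 0
  ... | false | true  = refl
  ... | true  | false = ⊥-elim (false≢true A<B)
  ... | true  | true  = lex<-suc L (A ∘ suc) (B ∘ suc) A<B
  ... | false | false = lex<-suc L (A ∘ suc) (B ∘ suc) A<B

  agree-cons : ∀ {L} {A B : ℕ → Bool} → A 0 ≡ B 0 → (∀ j → j < L → A (suc j) ≡ B (suc j)) → ∀ j → j < suc L → A j ≡ B j
  agree-cons A0≡B0 tails zero    _         = A0≡B0
  agree-cons A0≡B0 tails (suc j) (s≤s j<L) = tails j j<L

  lex<-trichotomy : ∀ L (A B : ℕ → Bool) → lex< L A B ≡ true ⊎ lex< L B A ≡ true ⊎ (∀ j → j < L → A j ≡ B j)
  lex<-trichotomy zero    A B = inj₂ (inj₂ (λ j ()))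
  lex<-trichotomy (suc L) A B with A 0 in A0 | B 0 in B0
  ... | false | true  = inj₁ refl
  ... | true  | false = inj₂ (inj₁ refl)
  ... | true  | true  = Data.Sum.map₂ (Data.Sum.map₂ (agree-cons (trans A0 (sym B0)))) (lex<-trichotomy L (A ∘ suc) (B ∘ suc))
  ... | false | false = Data.Sum.map₂ (Data.Sum.map₂ (agree-cons (trans A0 (sym B0)))) (lex<-trichotomy L (A ∘ suc) (B ∘ suc))

module Encoding where

  open Booleans
  open Permutations
  open Descents
  open Lexicographic
  open PeriodicWords using (Periodic; periodic-%; cycle; cycle-tabulate; hasPeriod; hasPeriod⇒periodic; periodic-cong; isPeriod; isPeriod-length; isPrimitive)
  open import Data.Nat using (_+_; _*_)
  open import Data.Nat.DivMod using (_%_; m%n<n)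
  open import Function.Definitions using (Injective)

  module _ {m : ℕ} (π : Vec (Fin (suc m)) (suc m)) where

    -- whether y lies in the second of the two increasing blocks of π
    colour : Fin (suc m) → Bool
    colour y = firstDescent π ≤ᵇ toℕ y

    orbitWord : Fin (suc m) → ℕ → Bool
    orbitWord x j = colour (iter π j x)

    encode : Fin (suc m) → Vec Bool (suc m)
    encode x = tabulate (orbitWord x ∘ toℕ)

  module _ {m : ℕ} (π : Vec (Fin (suc m)) (suc m)) (π-injective : Injective _≡_ _≡_ (lookup π))
           (π-cycle : ∀ k → k < m → iter π (suc k) fzero ≢ fzero) (grassmannian : desW π ≤ 1) where

    open NCycle π π-injective π-cycle

    entry-π : ∀ (y : Fin n) → entry π (toℕ y) ≡ toℕ (lookup π y)
    entry-π y = trans (entry-lookup π (toℕ y) (Finₚ.toℕ<n y)) (cong (toℕ ∘ lookup π) (Finₚ.fromℕ<-toℕ y (Finₚ.toℕ<n y)))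

    ascending : ∀ i → suc i < n → suc i ≢ firstDescent π → entry π i ≤ entry π (suc i)
    ascending i i<n i≢fd with ℕₚ.<-cmp (suc i) (firstDescent π)
    ... | tri< i<fd _ _ = ascending-before-firstDescent π i i<fd
    ... | tri≈ _ i≡fd _ = ⊥-elim (i≢fd i≡fd)
    ... | tri> _ _ fd<i = ascending-after-firstDescent π grassmannian i (ℕₚ.≤-pred fd<i) i<n

    ascending-run : ∀ a b → a ≤ b → b < n → (∀ i → a ≤ i → i < b → suc i ≢ firstDescent π) → entry π a ≤ entry π b
    ascending-run a b a≤b b<n no-descent with ℕₚ.m≤n⇒m<n∨m≡n a≤b
    ... | inj₂ refl = ℕₚ.≤-refl
    ascending-run a (suc b) _ b<n no-descent | inj₁ (s≤s a≤b) =
      ℕₚ.≤-trans (ascending-run a b a≤b (ℕₚ.<-trans (ℕₚ.n<1+n b) b<n) (λ i a≤i i<b → no-descent i a≤i (ℕₚ.m<n⇒m<1+n i<b)))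
                 (ascending b b<n (no-descent b a≤b ℕₚ.≤-refl))

    π-increasing-on-colours : ∀ (x y : Fin n) → toℕ x < toℕ y → colour π x ≡ colour π y → toℕ (lookup π x) < toℕ (lookup π y)
    π-increasing-on-colours x y x<y same-colour = ℕₚ.≤∧≢⇒< π-x≤π-y π-x≢π-y
      where
      no-descent : ∀ i → toℕ x ≤ i → i < toℕ y → suc i ≢ firstDescent π
      no-descent i x≤i i<y 1+i≡fd = false≢true (trans (sym (dec-false (firstDescent π ≤? toℕ x) x-below))
                                                      (trans same-colour (dec-true (firstDescent π ≤? toℕ y) y-above)))
        where
        x-below : ¬ firstDescent π ≤ toℕ x
        x-below fd≤x = ℕₚ.<⇒≱ (subst (toℕ x <_) 1+i≡fd (s≤s x≤i)) fd≤x
        y-above : firstDescent π ≤ toℕ y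
        y-above = subst (_≤ toℕ y) 1+i≡fd i<y
      π-x≤π-y : toℕ (lookup π x) ≤ toℕ (lookup π y)
      π-x≤π-y = subst₂ _≤_ (entry-π x) (entry-π y) (ascending-run (toℕ x) (toℕ y) (ℕₚ.<⇒≤ x<y) (Finₚ.toℕ<n y) no-descent)
      π-x≢π-y : toℕ (lookup π x) ≢ toℕ (lookup π y)
      π-x≢π-y eq = ℕₚ.<⇒≢ x<y (cong toℕ (π-injective (Finₚ.toℕ-injective eq)))

    orbitWord-suc : ∀ x j → orbitWord π x (suc j) ≡ orbitWord π (lookup π x) j
    orbitWord-suc x j = cong (colour π) (iter-suc j x)

    orbitWord-shift : ∀ x a j → orbitWord π x (a + j) ≡ orbitWord π (iter π a x) j
    orbitWord-shift x a j = cong (colour π) (trans (cong (λ t → iter π t x) (ℕₚ.+-comm a j)) (iter-+ j a x))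

    orbitWord-periodic : ∀ x → Periodic (orbitWord π x) n
    orbitWord-periodic x j = trans (orbitWord-shift x n j) (cong (λ y → orbitWord π y j) (iter-n x))

    orbitWord-agree : ∀ x y → (∀ j → j < n → orbitWord π x j ≡ orbitWord π y j) → ∀ j → orbitWord π x j ≡ orbitWord π y j
    orbitWord-agree x y agree j = trans (sym (periodic-% (orbitWord-periodic x) j))
                                        (trans (agree (j % n) (m%n<n j n)) (periodic-% (orbitWord-periodic y) j))

    orbitWords-respect-order : ∀ L x y → toℕ x < toℕ y → lex< L (orbitWord π y) (orbitWord π x) ≡ false
    orbitWords-respect-order zero    x y x<y = refl
    orbitWords-respect-order (suc L) x y x<y with colour π x in cx | colour π y in cy
    ... | false | true  = refl
    ... | true  | false = ⊥-elim (false≢true (trans (sym cy) (dec-true (firstDescent π ≤? toℕ y)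
                                    (ℕₚ.≤-trans (dec-witness (firstDescent π ≤? toℕ x) cx) (ℕₚ.<⇒≤ x<y)))))
    ... | true  | true  = trans (lex<-cong L (orbitWord-suc y) (orbitWord-suc x))
                                (orbitWords-respect-order L (lookup π x) (lookup π y) (π-increasing-on-colours x y x<y (trans cx (sym cy))))
    ... | false | false = trans (lex<-cong L (orbitWord-suc y) (orbitWord-suc x))
                                (orbitWords-respect-order L (lookup π x) (lookup π y) (π-increasing-on-colours x y x<y (trans cx (sym cy))))

    same-orbitWord⇒iterates-ordered : ∀ j x y → toℕ x < toℕ y → (∀ t → orbitWord π x t ≡ orbitWord π y t) →
                                      toℕ (iter π j x) < toℕ (iter π j y)
    same-orbitWord⇒iterates-ordered zero    x y x<y same = x<y
    same-orbitWord⇒iterates-ordered (suc j) x y x<y same =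
      π-increasing-on-colours (iter π j x) (iter π j y) (same-orbitWord⇒iterates-ordered j x y x<y same) (same j)

    -- With y = π^r x, equal words would make every π^j preserve x < y, so the orbit
    -- x < π^r x < π^(2r) x < ⋯ could never return to x.
    distinct-orbitWords : ∀ x y → toℕ x < toℕ y → ¬ (∀ t → orbitWord π x t ≡ orbitWord π y t)
    distinct-orbitWords x y x<y same with r , _ , refl ← orbit x y =
      ℕₚ.<-irrefl refl (ℕₚ.<-≤-trans (ℕₚ.m<m+n (toℕ x) {n} (s≤s z≤n)) (subst (λ z → toℕ x + n ≤ toℕ z) back (climb n)))
      where
      climb : ∀ k → toℕ x + k ≤ toℕ (iter π (k * r) x)
      climb zero    = ℕₚ.≤-reflexive (ℕₚ.+-identityʳ (toℕ x))
      climb (suc k) = begin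
        toℕ x + suc k                      ≡⟨ ℕₚ.+-suc (toℕ x) k ⟩
        suc (toℕ x + k)                    ≤⟨ s≤s (climb k) ⟩
        suc (toℕ (iter π (k * r) x))       ≤⟨ same-orbitWord⇒iterates-ordered (k * r) x (iter π r x) x<y same ⟩
        toℕ (iter π (k * r) (iter π r x))  ≡⟨ cong toℕ (sym (iter-+ (k * r) r x)) ⟩
        toℕ (iter π (k * r + r) x)         ≡⟨ cong (λ t → toℕ (iter π t x)) (ℕₚ.+-comm (k * r) r) ⟩
        toℕ (iter π (suc k * r) x)         ∎
        where open ℕₚ.≤-Reasoning
      back : iter π (n * r) x ≡ x
      back = trans (cong (λ t → iter π t x) (trans (ℕₚ.*-comm n r) (sym (ℕₚ.+-identityʳ (r * n))))) (iter-*n+ r 0 x)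

    orbitWord-injective : ∀ x y → (∀ t → orbitWord π x t ≡ orbitWord π y t) → x ≡ y
    orbitWord-injective x y same with ℕₚ.<-cmp (toℕ x) (toℕ y)
    ... | tri< x<y _ _ = ⊥-elim (distinct-orbitWords x y x<y same)
    ... | tri≈ _ x≡y _ = Finₚ.toℕ-injective x≡y
    ... | tri> _ _ y<x = ⊥-elim (distinct-orbitWords y x y<x (sym ∘ same))

    lex<-orbitWord : ∀ x y → lex< n (orbitWord π x) (orbitWord π y) ≡ (toℕ x <ᵇ toℕ y)
    lex<-orbitWord x y with ℕₚ.<-cmp (toℕ x) (toℕ y)
    ... | tri< x<y _ _ = trans smaller (sym (dec-true (toℕ x <? toℕ y) x<y))
      where
      smaller : lex< n (orbitWord π x) (orbitWord π y) ≡ true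
      smaller with lex<-trichotomy n (orbitWord π x) (orbitWord π y)
      ... | inj₁ x<y′        = x<y′
      ... | inj₂ (inj₁ y<x′) = ⊥-elim (false≢true (trans (sym (orbitWords-respect-order n x y x<y)) y<x′))
      ... | inj₂ (inj₂ same) = ⊥-elim (ℕₚ.<⇒≢ x<y (cong toℕ (orbitWord-injective x y (orbitWord-agree x y same))))
    ... | tri≈ _ x≡y _ rewrite Finₚ.toℕ-injective {i = x} {j = y} x≡y =
      trans (lex<-irrefl n (orbitWord π y)) (sym (dec-false (toℕ y <? toℕ y) (ℕₚ.<-irrefl refl)))
    ... | tri> _ _ y<x = trans (orbitWords-respect-order n y x y<x) (sym (dec-false (toℕ x <? toℕ y) (ℕₚ.<⇒≯ y<x)))

    cycle-encode : ∀ x j → cycle (encode π x) j ≡ orbitWord π x j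
    cycle-encode x = cycle-tabulate (orbitWord π x) (orbitWord-periodic x)

    encode-primitive : ∀ x → isPrimitive (encode π x) ≡ true
    encode-primitive x = ∧-intro (isPeriod-length (encode π x)) (all-upTo⁺ (not ∘ isPeriod (encode π x)) n no-shorter-period)
      where
      no-shorter-period : ∀ d → d < n → not (isPeriod (encode π x) d) ≡ true
      no-shorter-period zero    _   = refl
      no-shorter-period (suc d) d<n with hasPeriod (encode π x) (suc d) in per
      ... | false = refl
      ... | true  = ⊥-elim (no-fixed-point (suc d) (s≤s z≤n) d<n x (orbitWord-injective (iter π (suc d) x) x shifted))
        where
        shifted : ∀ t → orbitWord π (iter π (suc d) x) t ≡ orbitWord π x t
        shifted t = trans (sym (orbitWord-shift x (suc d) t))
                          (periodic-cong (cycle-encode x) {suc d} (hasPeriod⇒periodic (encode π x) (suc d) per) t)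

module Decoding where

  open Booleans
  open Permutations
  open Descents
  open Lexicographic
  open Search
  open PeriodicWords using (Periodic; periodic-multiple; periodic-%; cycle; cycle-%; cycle-periodic; cycle-lookup)
  open Encoding using (encode)
  open import Data.Nat using (_+_; _*_; _∸_)
  open import Data.Nat.DivMod using (_%_; m%n<n; %-distribˡ-+; m%n%n≡m%n)
  open import Function.Definitions using (Injective)

  module _ {m : ℕ} (u : Vec Bool (suc m)) where

    private
      n : ℕ
      n = suc m

    rotation : ℕ → ℕ → Bool
    rotation i j = cycle u (i + j)

    rank : ℕ → ℕ
    rank i = count n (λ l → lex< n (rotation l) (rotation i))

    rotation-% : ∀ i j → rotation i j ≡ rotation (i % n) j
    rotation-% i j = cycle-% u (i + j) (i % n + j)
      (trans (%-distribˡ-+ i j n) (sym (trans (%-distribˡ-+ (i % n) j n) (cong (λ t → (t + j % n) % n) (m%n%n≡m%n i n)))))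

    rotation-periodic : ∀ i → Periodic (rotation i) n
    rotation-periodic i j = trans (cong (cycle u) (trans (sym (ℕₚ.+-assoc i n j)) (trans (cong (_+ j) (ℕₚ.+-comm i n)) (ℕₚ.+-assoc n i j))))
                                  (cycle-periodic u (i + j))

    rotation-agree : ∀ a b → (∀ j → j < n → rotation a j ≡ rotation b j) → ∀ j → rotation a j ≡ rotation b j
    rotation-agree a b agree j = trans (sym (periodic-% (rotation-periodic a) j))
                                       (trans (agree (j % n) (m%n<n j n)) (periodic-% (rotation-periodic b) j))

    rank-cong : ∀ a b → (∀ j → rotation a j ≡ rotation b j) → rank a ≡ rank b
    rank-cong a b same = count-cong n _ _ (λ l _ → lex<-cong n {rotation l} {rotation l} {rotation a} {rotation b} (λ _ → refl) same)

    lex<-rotation-%-irrefl : ∀ i → lex< n (rotation (i % n)) (rotation i) ≡ false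
    lex<-rotation-%-irrefl i =
      trans (lex<-cong n {rotation (i % n)} {rotation i} {rotation i} {rotation i} (sym ∘ rotation-% i) (λ _ → refl)) (lex<-irrefl n (rotation i))

    rank-< : ∀ i → rank i < n
    rank-< i = count-< n (λ l → lex< n (rotation l) (rotation i)) (i % n) (m%n<n i n) (lex<-rotation-%-irrefl i)

    rank-strict : ∀ i j → lex< n (rotation i) (rotation j) ≡ true → rank i < rank j
    rank-strict i j i<j = count-strict n _ _ (λ l _ l<i → lex<-trans n (rotation l) (rotation i) (rotation j) l<i i<j)
      (i % n) (m%n<n i n) (trans (lex<-cong n {rotation (i % n)} {rotation i} {rotation j} (sym ∘ rotation-% i) (λ _ → refl)) i<j) (lex<-rotation-%-irrefl i)

    same-rank⇒same-rotation : ∀ a b → rank a ≡ rank b → ∀ j → rotation a j ≡ rotation b j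
    same-rank⇒same-rotation a b same with lex<-trichotomy n (rotation a) (rotation b)
    ... | inj₁ a<b        = ⊥-elim (ℕₚ.<⇒≢ (rank-strict a b a<b) same)
    ... | inj₂ (inj₁ b<a) = ⊥-elim (ℕₚ.<⇒≢ (rank-strict b a b<a) (sym same))
    ... | inj₂ (inj₂ agree) = rotation-agree a b agree

    rank-<⇒lex< : ∀ a b → rank a < rank b → lex< n (rotation a) (rotation b) ≡ true
    rank-<⇒lex< a b a<b with lex<-trichotomy n (rotation a) (rotation b)
    ... | inj₁ lex-a<b      = lex-a<b
    ... | inj₂ (inj₁ b<a)   = ⊥-elim (ℕₚ.<-asym a<b (rank-strict b a b<a))
    ... | inj₂ (inj₂ agree) = ⊥-elim (ℕₚ.<⇒≢ a<b (rank-cong a b (rotation-agree a b agree)))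

    rotation-suc : ∀ a b → (∀ j → rotation a j ≡ rotation b j) → ∀ j → rotation (suc a) j ≡ rotation (suc b) j
    rotation-suc a b same j = trans (cong (cycle u) (sym (ℕₚ.+-suc a j))) (trans (same (suc j)) (cong (cycle u) (ℕₚ.+-suc b j)))

    rotation-pred : ∀ a b → (∀ j → rotation (suc a) j ≡ rotation (suc b) j) → ∀ j → rotation a j ≡ rotation b j
    rotation-pred a b same j = begin
      cycle u (a + j)            ≡⟨ sym (cycle-periodic u (a + j)) ⟩
      cycle u (n + (a + j))      ≡⟨ cong (cycle u) (shift a) ⟩
      cycle u (suc a + (m + j))  ≡⟨ same (m + j) ⟩
      cycle u (suc b + (m + j))  ≡⟨ cong (cycle u) (sym (shift b)) ⟩
      cycle u (n + (b + j))      ≡⟨ cycle-periodic u (b + j) ⟩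
      cycle u (b + j)            ∎
      where
      open ≡-Reasoning
      shift : ∀ a → n + (a + j) ≡ suc a + (m + j)
      shift a = cong suc (trans (sym (ℕₚ.+-assoc m a j)) (trans (cong (_+ j) (ℕₚ.+-comm m a)) (ℕₚ.+-assoc a m j)))

    same-rotation⇒periodic : ∀ a b → a < b → (∀ j → rotation a j ≡ rotation b j) → Periodic (cycle u) (b ∸ a)
    same-rotation⇒periodic a b a<b same s = begin
      cycle u (b ∸ a + s)            ≡⟨ sym (periodic-multiple (cycle-periodic u) a (b ∸ a + s)) ⟩
      cycle u (a * n + (b ∸ a + s))  ≡⟨ cong (cycle u) (rearrange) ⟩
      cycle u (b + t)                ≡⟨ sym (same t) ⟩
      cycle u (a + t)                ≡⟨ cong (cycle u) a+t≡an+s ⟩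
      cycle u (a * n + s)            ≡⟨ periodic-multiple (cycle-periodic u) a s ⟩
      cycle u s                      ∎
      where
      open ≡-Reasoning
      t = (a * n ∸ a) + s
      a+t≡an+s : a + t ≡ a * n + s
      a+t≡an+s = trans (sym (ℕₚ.+-assoc a (a * n ∸ a) s)) (cong (_+ s) (ℕₚ.m+[n∸m]≡n (ℕₚ.m≤m*n a n)))
      rearrange : a * n + (b ∸ a + s) ≡ b + t
      rearrange = begin
        a * n + (b ∸ a + s)
          ≡⟨ trans (sym (ℕₚ.+-assoc (a * n) (b ∸ a) s)) (trans (cong (_+ s) (ℕₚ.+-comm (a * n) (b ∸ a))) (ℕₚ.+-assoc (b ∸ a) (a * n) s)) ⟩
        b ∸ a + (a * n + s)
          ≡⟨ cong (_+_ (b ∸ a)) (sym a+t≡an+s) ⟩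
        b ∸ a + (a + t)
          ≡⟨ sym (ℕₚ.+-assoc (b ∸ a) a t) ⟩
        b ∸ a + a + t
          ≡⟨ cong (_+ t) (ℕₚ.m∸n+n≡m (ℕₚ.<⇒≤ a<b)) ⟩
        b + t ∎

    rankFin : ℕ → Fin n
    rankFin i = fromℕ< (rank-< i)

    unrank : Fin n → ℕ
    unrank y = find (λ i → rank i ≡ᵇ toℕ y) n

    decode : Vec (Fin n) n
    decode = tabulate (λ y → rankFin (suc (unrank y)))

    zeros : ℕ
    zeros = count n (λ l → not (cycle u l))

    toℕ-rankFin : ∀ i → toℕ (rankFin i) ≡ rank i
    toℕ-rankFin i = Finₚ.toℕ-fromℕ< (rank-< i)

    rankFin-cong : ∀ a b → rank a ≡ rank b → rankFin a ≡ rankFin b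
    rankFin-cong a b same = Finₚ.toℕ-injective (trans (toℕ-rankFin a) (trans same (sym (toℕ-rankFin b))))

    same-rankFin⇒same-rotation : ∀ a b → rankFin a ≡ rankFin b → ∀ j → rotation a j ≡ rotation b j
    same-rankFin⇒same-rotation a b same =
      same-rank⇒same-rotation a b (trans (sym (toℕ-rankFin a)) (trans (cong toℕ same) (toℕ-rankFin b)))

    module _ (aperiodic : ∀ d → 1 ≤ d → d < n → ¬ Periodic (cycle u) d) where

      rank-injective : ∀ i j → i < n → j < n → rank i ≡ rank j → i ≡ j
      rank-injective i j i<n j<n same with ℕₚ.<-cmp i j
      ... | tri≈ _ i≡j _ = i≡j
      ... | tri< i<j _ _ = ⊥-elim (aperiodic (j ∸ i) (ℕₚ.m<n⇒0<n∸m i<j) (ℕₚ.≤-<-trans (ℕₚ.m∸n≤m j i) j<n)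
                                             (same-rotation⇒periodic i j i<j (same-rank⇒same-rotation i j same)))
      ... | tri> _ _ j<i = ⊥-elim (aperiodic (i ∸ j) (ℕₚ.m<n⇒0<n∸m j<i) (ℕₚ.≤-<-trans (ℕₚ.m∸n≤m i j) i<n)
                                             (same-rotation⇒periodic j i j<i (same-rank⇒same-rotation j i (sym same))))

      unrank-spec : ∀ y → unrank y < n × rank (unrank y) ≡ toℕ y
      unrank-spec y = Data.Product.map (λ h → h) (dec-witness (rank (unrank y) ≟ toℕ y))
        (find-found (λ i → rank i ≡ᵇ toℕ y) n (toℕ k) (Finₚ.toℕ<n k)
                    (dec-true (rank (toℕ k) ≟ toℕ y) (trans (sym (toℕ-rankFin (toℕ k))) (cong toℕ k↦y))))
        where
        rankFin-injective : Injective _≡_ _≡_ (rankFin ∘ toℕ)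
        rankFin-injective {k} {k′} eq = Finₚ.toℕ-injective (rank-injective (toℕ k) (toℕ k′) (Finₚ.toℕ<n k) (Finₚ.toℕ<n k′)
                                          (trans (sym (toℕ-rankFin (toℕ k))) (trans (cong toℕ eq) (toℕ-rankFin (toℕ k′)))))
        preimage = injective⇒surjective (rankFin ∘ toℕ) rankFin-injective y
        k = proj₁ preimage
        k↦y = proj₂ preimage

      rankFin-unrank : ∀ y → rankFin (unrank y) ≡ y
      rankFin-unrank y = Finₚ.toℕ-injective (trans (toℕ-rankFin (unrank y)) (proj₂ (unrank-spec y)))

      decode-step : ∀ a → lookup decode (rankFin a) ≡ rankFin (suc a)
      decode-step a = trans (Vecₚ.lookup∘tabulate (λ y → rankFin (suc (unrank y))) (rankFin a))
        (rankFin-cong (suc (unrank (rankFin a))) (suc a) (rank-cong (suc (unrank (rankFin a))) (suc a)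
          (rotation-suc (unrank (rankFin a)) a (same-rankFin⇒same-rotation (unrank (rankFin a)) a (rankFin-unrank (rankFin a))))))

      decode-iter : ∀ j a → iter decode j (rankFin a) ≡ rankFin (j + a)
      decode-iter zero    a = refl
      decode-iter (suc j) a = trans (cong (lookup decode) (decode-iter j a)) (decode-step (j + a))

      decode-injective : Injective _≡_ _≡_ (lookup decode)
      decode-injective {y} {y′} eq = begin
        y                    ≡⟨ sym (rankFin-unrank y) ⟩
        rankFin (unrank y)   ≡⟨ rankFin-cong (unrank y) (unrank y′) (rank-cong (unrank y) (unrank y′) same-rotation) ⟩
        rankFin (unrank y′)  ≡⟨ rankFin-unrank y′ ⟩
        y′                   ∎
        where
        open ≡-Reasoning
        step : rankFin (suc (unrank y)) ≡ rankFin (suc (unrank y′))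
        step = trans (sym (Vecₚ.lookup∘tabulate (λ y → rankFin (suc (unrank y))) y))
                     (trans eq (Vecₚ.lookup∘tabulate (λ y → rankFin (suc (unrank y))) y′))
        same-rotation : ∀ j → rotation (unrank y) j ≡ rotation (unrank y′) j
        same-rotation = rotation-pred (unrank y) (unrank y′) (same-rankFin⇒same-rotation (suc (unrank y)) (suc (unrank y′)) step)

      decode-cycle : ∀ k → k < m → iter decode (suc k) fzero ≢ fzero
      decode-cycle k k<m returns = aperiodic (suc k) (s≤s z≤n) (s≤s k<m)
        (subst (Periodic (cycle u)) (ℕₚ.m+n∸n≡m (suc k) i₀)
               (same-rotation⇒periodic i₀ (suc k + i₀) (ℕₚ.m<n+m i₀ (s≤s z≤n)) (sym ∘ same-rankFin⇒same-rotation (suc k + i₀) i₀ back)))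
        where
        i₀ = unrank fzero
        back : rankFin (suc k + i₀) ≡ rankFin i₀
        back = begin
          rankFin (suc k + i₀)              ≡⟨ sym (decode-iter (suc k) i₀) ⟩
          iter decode (suc k) (rankFin i₀)  ≡⟨ cong (iter decode (suc k)) (rankFin-unrank fzero) ⟩
          iter decode (suc k) fzero         ≡⟨ returns ⟩
          fzero                             ≡⟨ sym (rankFin-unrank fzero) ⟩
          rankFin i₀                        ∎
          where open ≡-Reasoning

      module _ (1≤m : 1 ≤ m) where

        rotation-head : ∀ l → rotation l 0 ≡ cycle u l
        rotation-head l = cong (cycle u) (ℕₚ.+-identityʳ l)

        rank<zeros : ∀ i → cycle u i ≡ false → rank i < zeros
        rank<zeros i ui≡0 = count-strict n (λ l → lex< n (rotation l) (rotation i)) (λ l → not (cycle u l)) smaller-starts-with-0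
          (i % n) (m%n<n i n) (cong not (trans (cycle-% u (i % n) i (m%n%n≡m%n i n)) ui≡0)) (lex<-rotation-%-irrefl i)
          where
          smaller-starts-with-0 : ∀ l → l < n → lex< n (rotation l) (rotation i) ≡ true → not (cycle u l) ≡ true
          smaller-starts-with-0 l _ l<i with cycle u l in ul
          ... | false = refl
          ... | true  = ⊥-elim (false≢true (trans (sym ui≡0) (trans (sym (rotation-head i))
                          (lex<-head-true n (rotation l) (rotation i) l<i (trans (rotation-head l) ul)))))

        zeros≤rank : ∀ i → cycle u i ≡ true → zeros ≤ rank i
        zeros≤rank i ui≡1 = count-mono n (λ l → not (cycle u l)) (λ l → lex< n (rotation l) (rotation i)) starting-with-0-smaller
          where
          starting-with-0-smaller : ∀ l → l < n → not (cycle u l) ≡ true → lex< n (rotation l) (rotation i) ≡ true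
          starting-with-0-smaller l _ ul≡0 = lex<-head m (rotation l) (rotation i)
            (trans (rotation-head l) (trans (sym (Boolₚ.not-involutive (cycle u l))) (cong not ul≡0))) (trans (rotation-head i) ui≡1)

        rank<ᵇzeros : ∀ i → (rank i <ᵇ zeros) ≡ not (cycle u i)
        rank<ᵇzeros i with cycle u i in ui
        ... | false = dec-true (rank i <? zeros) (rank<zeros i ui)
        ... | true  = dec-false (rank i <? zeros) (ℕₚ.≤⇒≯ (zeros≤rank i ui))

        below-zeros : ∀ y → (toℕ y <ᵇ zeros) ≡ not (cycle u (unrank y))
        below-zeros y = trans (cong (_<ᵇ zeros) (sym (proj₂ (unrank-spec y)))) (rank<ᵇzeros (unrank y))

        toℕ-decode : ∀ y → toℕ (lookup decode y) ≡ rank (suc (unrank y))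
        toℕ-decode y = trans (cong toℕ (Vecₚ.lookup∘tabulate (λ y → rankFin (suc (unrank y))) y)) (toℕ-rankFin (suc (unrank y)))

        decode-increasing-on-letters : ∀ y y′ → toℕ y′ ≡ suc (toℕ y) → cycle u (unrank y) ≡ cycle u (unrank y′) →
                                       toℕ (lookup decode y) < toℕ (lookup decode y′)
        decode-increasing-on-letters y y′ y′≡1+y same-letter =
          subst₂ _<_ (sym (toℕ-decode y)) (sym (toℕ-decode y′)) (rank-strict (suc i) (suc i′) tails<)
          where
          i = unrank y
          i′ = unrank y′
          ranks< : rank i < rank i′
          ranks< = subst₂ _<_ (sym (proj₂ (unrank-spec y))) (sym (proj₂ (unrank-spec y′))) (subst (toℕ y <_) (sym y′≡1+y) (ℕₚ.n<1+n (toℕ y)))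
          tails< : lex< n (rotation (suc i)) (rotation (suc i′)) ≡ true
          tails< = trans (lex<-cong n (λ j → cong (cycle u) (sym (ℕₚ.+-suc i j))) (λ j → cong (cycle u) (sym (ℕₚ.+-suc i′ j))))
                         (lex<-suc m _ _ (trans (sym (lex<-tail m (rotation i) (rotation i′)
                                                                 (trans (rotation-head i) (trans same-letter (sym (rotation-head i′))))))
                                                (rank-<⇒lex< i i′ ranks<)))

        decode-ascending : ∀ k → suc k < n → suc k ≢ zeros → entry decode k < entry decode (suc k)
        decode-ascending k 1+k<n 1+k≢zeros =
          subst₂ _<_ (sym (entry-lookup decode k k<n)) (sym (entry-lookup decode (suc k) 1+k<n))
                 (decode-increasing-on-letters y y′ (trans (Finₚ.toℕ-fromℕ< 1+k<n) (cong suc (sym (Finₚ.toℕ-fromℕ< k<n)))) same-letter)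
          where
          k<n = ℕₚ.<-trans (ℕₚ.n<1+n k) 1+k<n
          y = fromℕ< k<n
          y′ = fromℕ< 1+k<n
          same-side : (k <ᵇ zeros) ≡ (suc k <ᵇ zeros)
          same-side = ≡-by-≡true (λ h → dec-true (suc k <? zeros) (ℕₚ.≤∧≢⇒< (dec-witness (k <? zeros) h) 1+k≢zeros))
                                 (λ h → dec-true (k <? zeros) (ℕₚ.<-trans (ℕₚ.n<1+n k) (dec-witness (suc k <? zeros) h)))
          same-letter : cycle u (unrank y) ≡ cycle u (unrank y′)
          same-letter = Boolₚ.not-injective (begin
            not (cycle u (unrank y))    ≡⟨ sym (below-zeros y) ⟩
            (toℕ y <ᵇ zeros)            ≡⟨ cong (_<ᵇ zeros) (Finₚ.toℕ-fromℕ< k<n) ⟩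
            (k <ᵇ zeros)                ≡⟨ same-side ⟩
            (suc k <ᵇ zeros)            ≡⟨ cong (_<ᵇ zeros) (sym (Finₚ.toℕ-fromℕ< 1+k<n)) ⟩
            (toℕ y′ <ᵇ zeros)           ≡⟨ below-zeros y′ ⟩
            not (cycle u (unrank y′))   ∎)
            where open ≡-Reasoning

        decode-grassmannian : desW decode ≤ 1
        decode-grassmannian = ascending-but-one⇒des≤1 decode zeros (λ i i<n i≢z → ℕₚ.<⇒≤ (decode-ascending i i<n i≢z))

        letter-occurs : ∀ b → Σ[ l ∈ ℕ ] l < n × cycle u l ≡ b
        letter-occurs b with Finₚ.any? (λ (l : Fin n) → cycle u (toℕ l) Boolₚ.≟ b)
        ... | yes (l , ul≡b) = toℕ l , Finₚ.toℕ<n l , ul≡b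
        ... | no  absent     = ⊥-elim (aperiodic 1 ℕₚ.≤-refl (s≤s 1≤m) (λ j → trans (other (1 + j)) (sym (other j))))
          where
          other : ∀ l → cycle u l ≡ not b
          other l = Boolₚ.¬-not (λ ul≡b → absent (fromℕ< (m%n<n l n) ,
                      trans (cong (cycle u) (Finₚ.toℕ-fromℕ< (m%n<n l n))) (trans (periodic-% (cycle-periodic u) l) ul≡b)))

        1≤zeros : 1 ≤ zeros
        1≤zeros = let (l , l<n , ul≡0) = letter-occurs false in count-> n (λ l → not (cycle u l)) l l<n (cong not ul≡0)

        zeros<n : zeros < n
        zeros<n = let (l , l<n , ul≡1) = letter-occurs true in count-< n (λ l → not (cycle u l)) l l<n (cong not ul≡1)

        -- Otherwise decode would be increasing, hence the identity, and the rotations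
        -- 0 and 1 of u would have the same rank.
        descent-at-zeros : entry decode zeros < entry decode (zeros ∸ 1)
        descent-at-zeros = decidable-stable (entry decode zeros <? entry decode (zeros ∸ 1)) λ no-descent →
          ℕₚ.1+n≢0 (rank-injective 1 0 (s≤s 1≤m) (s≤s z≤n) (trans (sym (toℕ-rankFin 1)) (trans (cong toℕ (fixed no-descent)) (toℕ-rankFin 0))))
          where
          k<n : ∀ {k} → suc k < n → k < n
          k<n 1+k<n = ℕₚ.<-trans (ℕₚ.n<1+n _) 1+k<n
          entry-injective : ∀ a b (a<n : a < n) (b<n : b < n) → entry decode a ≡ entry decode b → a ≡ b
          entry-injective a b a<n b<n eq = trans (sym (Finₚ.toℕ-fromℕ< a<n)) (trans (cong toℕ (decode-injective (Finₚ.toℕ-injective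
            (trans (sym (entry-lookup decode a a<n)) (trans eq (entry-lookup decode b b<n)))))) (Finₚ.toℕ-fromℕ< b<n))
          increasing : ¬ entry decode zeros < entry decode (zeros ∸ 1) → ∀ k → suc k < n → entry decode k < entry decode (suc k)
          increasing no-descent k 1+k<n = at-zeros-or-not (suc k ≟ zeros)
            where
            at-zeros-or-not : Dec (suc k ≡ zeros) → entry decode k < entry decode (suc k)
            at-zeros-or-not (no  1+k≢zeros) = decode-ascending k 1+k<n 1+k≢zeros
            at-zeros-or-not (yes 1+k≡zeros) = ℕₚ.≤∧≢⇒< ascent (λ eq → ℕₚ.1+n≢n (sym (entry-injective k (suc k) (k<n 1+k<n) 1+k<n eq)))
              where
              ascent : entry decode k ≤ entry decode (suc k)
              ascent = subst (λ z → entry decode (z ∸ 1) ≤ entry decode z) (sym 1+k≡zeros) (ℕₚ.≮⇒≥ no-descent)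
          bounded : ∀ k → k < n → entry decode k < n
          bounded k k<n = subst (_< n) (sym (entry-lookup decode k k<n)) (Finₚ.toℕ<n (lookup decode (fromℕ< k<n)))
          r₀ = rankFin 0
          fixed : ¬ entry decode zeros < entry decode (zeros ∸ 1) → rankFin 1 ≡ rankFin 0
          fixed no-descent = trans (sym (decode-step 0)) (Finₚ.toℕ-injective (begin
            toℕ (lookup decode r₀)
              ≡⟨ cong (toℕ ∘ lookup decode) (sym (Finₚ.fromℕ<-toℕ r₀ (Finₚ.toℕ<n r₀))) ⟩
            toℕ (lookup decode (fromℕ< (Finₚ.toℕ<n r₀)))
              ≡⟨ sym (entry-lookup decode (toℕ r₀) (Finₚ.toℕ<n r₀)) ⟩
            entry decode (toℕ r₀)
              ≡⟨ strictly-increasing⇒id n (entry decode) (increasing no-descent) bounded (toℕ r₀) (Finₚ.toℕ<n r₀) ⟩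
            toℕ r₀                                       ∎))
            where open ≡-Reasoning

        firstDescent-decode : firstDescent decode ≡ zeros
        firstDescent-decode = firstDescent-≡ decode zeros 1≤zeros zeros<n
          (λ i 1+i<z → ℕₚ.<⇒≤ (decode-ascending i (ℕₚ.<-trans 1+i<z zeros<n) (λ eq → ℕₚ.<-irrefl eq 1+i<z))) descent-at-zeros

        encode-decode : encode decode (rankFin 0) ≡ u
        encode-decode = trans (Vecₚ.tabulate-cong letter) (Vecₚ.tabulate∘lookup u)
          where
          letter : ∀ i → (firstDescent decode ≤ᵇ toℕ (iter decode (toℕ i) (rankFin 0))) ≡ lookup u i
          letter i = begin
            firstDescent decode ≤ᵇ toℕ (iter decode (toℕ i) (rankFin 0))
              ≡⟨ cong₂ (λ a b → a ≤ᵇ toℕ b) firstDescent-decode (decode-iter (toℕ i) 0) ⟩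
            zeros ≤ᵇ toℕ (rankFin (toℕ i + 0))
              ≡⟨ cong (zeros ≤ᵇ_) (toℕ-rankFin (toℕ i + 0)) ⟩
            zeros ≤ᵇ rank (toℕ i + 0)
              ≡⟨ ≤ᵇ≡not-<ᵇ zeros (rank (toℕ i + 0)) ⟩
            not (rank (toℕ i + 0) <ᵇ zeros)
              ≡⟨ cong not (rank<ᵇzeros (toℕ i + 0)) ⟩
            not (not (cycle u (toℕ i + 0)))
              ≡⟨ Boolₚ.not-involutive _ ⟩
            cycle u (toℕ i + 0)
              ≡⟨ cong (cycle u) (ℕₚ.+-identityʳ (toℕ i)) ⟩
            cycle u (toℕ i)
              ≡⟨ cycle-lookup u i ⟩
            lookup u i ∎
            where
            open ≡-Reasoning
            ≤ᵇ≡not-<ᵇ : ∀ a b → (a ≤ᵇ b) ≡ not (b <ᵇ a)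
            ≤ᵇ≡not-<ᵇ a b with a ≤? b
            ... | yes a≤b = trans (dec-true (a ≤? b) a≤b) (sym (cong not (dec-false (b <? a) (ℕₚ.≤⇒≯ a≤b))))
            ... | no  a≰b = trans (dec-false (a ≤? b) a≰b) (sym (cong not (dec-true (b <? a) (ℕₚ.≰⇒> a≰b))))

        decode-valid : (isPerm decode ∧ isNCycle decode ∧ isGrassmannian decode) ≡ true
        decode-valid = ∧-intro permutation (∧-intro n-cycle (dec-true (desW decode ≤? 1) decode-grassmannian))
          where
          permutation : isPerm decode ≡ true
          permutation = subst (λ v → isPerm v ≡ true) (Vecₚ.tabulate∘lookup decode)
                              (injective⇒isPerm (lookup decode) decode-injective)
          n-cycle : isNCycle decode ≡ true
          n-cycle = all-upTo⁺ _ m (λ k k<m → cong not (dec-false (toℕ (iter decode (suc k) fzero) ≟ 0)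
                                                         (decode-cycle k k<m ∘ Finₚ.toℕ-injective)))

module RoundTrip where

  open Booleans
  open Sums
  open Enumerations
  open Search
  open Permutations
  open Lexicographic
  open PeriodicWords using (isPrimitive⇒aperiodic)
  open Encoding
  open Decoding
  open import Data.Nat using (_+_; _∸_)
  open import Data.Integer using () renaming (_+_ to _+ℤ_)
  open import Function.Definitions using (Injective)

  ∑-allFin-below : ∀ n t → t ≤ n → ∑[ y ∈ allFin n ] χ (toℕ y <ᵇ t) ≡ + t
  ∑-allFin-below zero    zero    _         = refl
  ∑-allFin-below (suc n) zero    _         = trans (∑-allFin-suc n (λ y → χ (toℕ y <ᵇ 0))) (cong (_+ℤ_ (+ 0)) (∑-zero (allFin n) (λ _ → refl)))
  ∑-allFin-below (suc n) (suc t) (s≤s t≤n) =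
    trans (∑-allFin-suc n (λ y → χ (toℕ y <ᵇ suc t))) (cong (_+ℤ_ (+ 1)) (∑-allFin-below n t t≤n))

  module _ {m : ℕ} (π : Vec (Fin (suc m)) (suc m)) (π-injective : Injective _≡_ _≡_ (lookup π))
           (π-cycle : ∀ k → k < m → iter π (suc k) fzero ≢ fzero) (grassmannian : desW π ≤ 1) (x : Fin (suc m)) where

    open NCycle π π-injective π-cycle

    private
      u : Vec Bool n
      u = encode π x

    rotation-encode : ∀ i j → rotation u i j ≡ orbitWord π (iter π i x) j
    rotation-encode i j = trans (cycle-encode π π-injective π-cycle grassmannian x (i + j)) (orbitWord-shift π π-injective π-cycle grassmannian x i j)

    iterates-distinct : ∀ a b → a < n → b < n → iter π a x ≡ iter π b x → a ≡ b
    iterates-distinct a b a<n b<n eq with ℕₚ.<-cmp a b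
    ... | tri≈ _ a≡b _ = a≡b
    ... | tri< a<b _ _ = ⊥-elim (no-fixed-point (b ∸ a) (ℕₚ.m<n⇒0<n∸m a<b) (ℕₚ.≤-<-trans (ℕₚ.m∸n≤m b a) b<n) (iter π a x)
                                                (trans (iter-∸ x (ℕₚ.<⇒≤ a<b)) (sym eq)))
    ... | tri> _ _ b<a = ⊥-elim (no-fixed-point (a ∸ b) (ℕₚ.m<n⇒0<n∸m b<a) (ℕₚ.≤-<-trans (ℕₚ.m∸n≤m a b) a<n) (iter π b x)
                                                (trans (iter-∸ x (ℕₚ.<⇒≤ b<a)) eq))

    count-iterates-below : ∀ t → t < n → count n (λ l → toℕ (iter π l x) <ᵇ t) ≡ t
    count-iterates-below t t<n = ℤₚ.+-injective (begin
      + count n (λ l → toℕ (iter π l x) <ᵇ t)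
        ≡⟨ count-∑ n _ ⟩
      ∑[ l ∈ upTo n ] χ (toℕ (iter π l x) <ᵇ t)
        ≡⟨ ∑-upTo-cong n (λ l l<n → cong (λ b → χ (b ∧ (toℕ (iter π l x) <ᵇ t))) (sym (dec-true (l <? n) l<n))) ⟩
      ∑[ l ∈ upTo n ] χ ((l <ᵇ n) ∧ (toℕ (iter π l x) <ᵇ t))
        ≡⟨ ∑-reindex-χ (enumerates-upTo n) (enumerates-allFin n) (proj₁ ∘ ∧-elim) (λ _ → refl) iterate ⟩
      ∑[ y ∈ allFin n ] χ (toℕ y <ᵇ t)
        ≡⟨ ∑-allFin-below n t (ℕₚ.<⇒≤ t<n) ⟩
      + t                                                           ∎)
      where
      open ≡-Reasoning
      iterate : SubsetBijection (λ l → (l <ᵇ n) ∧ (toℕ (iter π l x) <ᵇ t)) (λ y → toℕ y <ᵇ t)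
      iterate = record
        { to      = λ l → iter π l x
        ; from    = λ y → proj₁ (orbit x y)
        ; to-∈    = proj₂ ∘ ∧-elim
        ; from-∈  = λ {y} y<t → let (_ , r<n , r↦y) = orbit x y in
                      ∧-intro (dec-true (_ <? n) r<n) (subst (λ z → (toℕ z <ᵇ t) ≡ true) (sym r↦y) y<t)
        ; from∘to = λ {l} h → let (_ , r<n , r↦) = orbit x (iter π l x) in iterates-distinct _ l r<n (dec-witness (l <? n) (proj₁ (∧-elim h))) r↦
        ; to∘from = λ {y} _ → proj₂ (proj₂ (orbit x y))
        }

    rank-encode : ∀ i → rank u i ≡ toℕ (iter π i x)
    rank-encode i = begin
      count n (λ l → lex< n (rotation u l) (rotation u i))
        ≡⟨ count-cong n _ _ (λ l _ → lex<-cong n (rotation-encode l) (rotation-encode i)) ⟩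
      count n (λ l → lex< n (orbitWord π (iter π l x)) (orbitWord π (iter π i x)))
        ≡⟨ count-cong n _ _ (λ l _ → lex<-orbitWord π π-injective π-cycle grassmannian (iter π l x) (iter π i x)) ⟩
      count n (λ l → toℕ (iter π l x) <ᵇ toℕ (iter π i x))
        ≡⟨ count-iterates-below (toℕ (iter π i x)) (Finₚ.toℕ<n _) ⟩
      toℕ (iter π i x) ∎
      where open ≡-Reasoning

    rankFin-encode : ∀ i → rankFin u i ≡ iter π i x
    rankFin-encode i = Finₚ.toℕ-injective (trans (toℕ-rankFin u i) (rank-encode i))

    decode-encode : (decode u , rankFin u 0) ≡ (π , x)
    decode-encode = cong₂ _,_ (trans (Vecₚ.tabulate-cong step) (Vecₚ.tabulate∘lookup π)) (rankFin-encode 0)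
      where
      aperiodic = isPrimitive⇒aperiodic u (encode-primitive π π-injective π-cycle grassmannian x)
      step : ∀ y → rankFin u (suc (unrank u y)) ≡ lookup π y
      step y = trans (rankFin-encode (suc (unrank u y)))
                     (cong (lookup π) (Finₚ.toℕ-injective (trans (sym (rank-encode (unrank u y))) (proj₂ (unrank-spec u aperiodic y)))))

module GrassmannianCycles where

  open Booleans
  open Sums
  open Enumerations
  open Permutations
  open PeriodicWords using (binaryWords; enumerates-binaryWords; isPrimitive; primitiveCount; isPrimitive⇒aperiodic)
  open Encoding
  open Decoding
  open RoundTrip
  open import Data.Integer using () renaming (_*_ to _*ℤ_)
  open import Function.Definitions using (Injective)

  isGrassmannianNCycle : ∀ {n} → Vec (Fin n) n → Bool
  isGrassmannianNCycle π = isPerm π ∧ isNCycle π ∧ isGrassmannian π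

  isGrassmannianNCycle⁻ : ∀ {m} (π : Vec (Fin (suc m)) (suc m)) → isGrassmannianNCycle π ≡ true →
                          Injective _≡_ _≡_ (lookup π) × (∀ k → k < m → iter π (suc k) fzero ≢ fzero) × desW π ≤ 1
  isGrassmannianNCycle⁻ {m} π h with perm , rest ← ∧-elim {isPerm π} h with n-cycle , grassmannian ← ∧-elim {isNCycle π} rest =
    isPerm⇒injective π perm , returns-late , dec-witness (desW π ≤? 1) grassmannian
    where
    returns-late : ∀ k → k < m → iter π (suc k) fzero ≢ fzero
    returns-late k k<m returns = false≢true (trans (sym (cong not (dec-true (toℕ (iter π (suc k) fzero) ≟ 0) (cong toℕ returns))))
                                                   (all-upTo⁻ _ m n-cycle k k<m))

  allWords≡vectors : ∀ k n → allWords k n ≡ vectors (allFin n) k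
  allWords≡vectors zero    n = refl
  allWords≡vectors (suc k) n = cong (λ ws → concatMap (λ x → map (x ∷_) ws) (allFin n)) (allWords≡vectors k n)

  enumerates-allWords : ∀ n → Complete (Vecₚ.≡-dec Finₚ._≟_) (allWords n n)
  enumerates-allWords n = subst (Complete (Vecₚ.≡-dec Finₚ._≟_)) (sym (allWords≡vectors n n)) (enumerates-vectors (enumerates-allFin n) n)

  n·N≡primitiveCount : ∀ n → 2 ≤ n → + n *ℤ + N n ≡ primitiveCount n
  n·N≡primitiveCount n@(suc m) (s≤s 1≤m) = begin
    + n *ℤ + N n
      ≡⟨ cong₂ _*ℤ_ (cong +_ (sym (Listₚ.length-tabulate {n = n} (λ i → i)))) (length-filterᵇ isGrassmannianNCycle W) ⟩
    + length (allFin n) *ℤ (∑[ π ∈ W ] χ (isGrassmannianNCycle π))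
      ≡⟨ sym (∑-pairs-proj₁ W (allFin n) (χ ∘ isGrassmannianNCycle)) ⟩
    ∑[ q ∈ pairs W (allFin n) ] χ (isGrassmannianNCycle (proj₁ q))
      ≡⟨ ∑-reindex-χ (enumerates-pairs (enumerates-allWords n) (enumerates-allFin n)) (enumerates-binaryWords n)
                     (λ _ → refl) (λ _ → refl) encoding ⟩
    ∑[ u ∈ binaryWords n ] χ (isPrimitive u) ∎
    where
    open ≡-Reasoning
    W = allWords n n
    encoding : SubsetBijection (isGrassmannianNCycle ∘ proj₁) isPrimitive
    encoding = record
      { to      = λ (π , x) → encode π x
      ; from    = λ u → decode u , rankFin u 0
      ; to-∈    = λ { {π , x} h → let (inj , cyc , gr) = isGrassmannianNCycle⁻ π h in encode-primitive π inj cyc gr x }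
      ; from-∈  = λ {u} h → decode-valid u (isPrimitive⇒aperiodic u h) 1≤m
      ; from∘to = λ { {π , x} h → let (inj , cyc , gr) = isGrassmannianNCycle⁻ π h in decode-encode π inj cyc gr x }
      ; to∘from = λ {u} h → encode-decode u (isPrimitive⇒aperiodic u h) 1≤m
      }

open import Data.Integer using (_*_; _-_)
open import Data.Nat using (_^_; nonTrivial⇒n>1)
open import Data.Nat.Primality using (Prime; prime⇒nonTrivial)
open DivisorSums using (∑-factorisations; möbius-inversion; sumProperDivisors-μ; sumProperDivisors-prime)
open PeriodicWords using (primitiveCount; ∑-factorisations-primitiveCount)
open GrassmannianCycles using (n·N≡primitiveCount)

lemma3p3 : ((n : ℕ) → 2 ≤ n →
              + n * + N n ≡ sumProperDivisors n (λ d e → μ d * (+ (2 ^ e) - + 2)))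
           × ((p : ℕ) → Prime p → + p * + N p ≡ + (2 ^ p) - + 2)
lemma3p3 = count-formula , prime-formula
  where
  open ≡-Reasoning
  count-formula : (n : ℕ) → 2 ≤ n → + n * + N n ≡ sumProperDivisors n (λ d e → μ d * (+ (2 ^ e) - + 2))
  count-formula n@(suc _) 2≤n = begin
    + n * + N n
      ≡⟨ n·N≡primitiveCount n 2≤n ⟩
    primitiveCount n
      ≡⟨ sym (möbius-inversion (λ e → + (2 ^ e)) primitiveCount ∑-factorisations-primitiveCount n) ⟩
    ∑-factorisations n (λ d e → μ d * + (2 ^ e))
      ≡⟨ sym (sumProperDivisors-μ n 2≤n (λ e → + (2 ^ e))) ⟩
    sumProperDivisors n (λ d e → μ d * (+ (2 ^ e) - + 2)) ∎
  prime-formula : (p : ℕ) → Prime p → + p * + N p ≡ + (2 ^ p) - + 2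
  prime-formula p p-prime = begin
    + p * + N p                                            ≡⟨ count-formula p (nonTrivial⇒n>1 p {{prime⇒nonTrivial p-prime}}) ⟩
    sumProperDivisors p (λ d e → μ d * (+ (2 ^ e) - + 2))  ≡⟨ sumProperDivisors-prime p-prime (λ d e → μ d * (+ (2 ^ e) - + 2)) ⟩
    μ 1 * (+ (2 ^ p) - + 2)                                ≡⟨ ℤₚ.*-identityˡ (+ (2 ^ p) - + 2) ⟩
    + (2 ^ p) - + 2                                        ∎
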